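{- Let $P(x,y)$ be a generating polynomial. The number of irreducible factors in the prime factorization of $P(x,y)$ over $\mathbb Z[x,y]$ is at most the number of irreducible factors in the prime factorization of the univariate polynomial $P(x,x)$ over $\mathbb Z[x]$. In particular, if $P(x,x)$ is irreducible, then so is $P(x,y)$.
   Context: The generating polynomial of a binary string $s=s_1\cdots s_n$ is $P_s(x,y)=\sum_{i=0}^n x^{a_i}y^{b_i}$, where $a_i,b_i$ are the numbers of 0's and 1's among $s_1,\dots,s_i$; a generating polynomial is one of this form for some binary string. -}

module Defs where

open import Data.Nat as ℕ using (ℕ; zero; suc; _∸_; _≡ᵇ_)
open import Data.Integer using (ℤ; +_; _+_; _*_; 0ℤ; 1ℤ)
open import Data.Bool using (Bool; true; false; if_then_else_; _∧_)
open import Data.List using (List; []; _∷_; foldr; length)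
open import Data.List.Relation.Unary.All using (All)
open import Data.Product using (Σ; _×_; _,_; ∃)
open import Relation.Binary.PropositionalEquality using (_≡_)
open import Relation.Nullary using (¬_)

sumTo : ℕ → (ℕ → ℤ) → ℤ
sumTo zero    f = f 0
sumTo (suc n) f = sumTo n f + f (suc n)

-- Univariate polynomials over ℤ: coefficient functions ℕ → ℤ
-- (coefficient of x^k), required to have finite support.

Coeffs₁ : Set
Coeffs₁ = ℕ → ℤ

IsPoly₁ : Coeffs₁ → Set
IsPoly₁ f = ∃ λ N → ∀ k → N ℕ.≤ k → f k ≡ 0ℤ

_≈₁_ : Coeffs₁ → Coeffs₁ → Set
f ≈₁ g = ∀ k → f k ≡ g k

one₁ : Coeffs₁
one₁ zero    = 1ℤ
one₁ (suc _) = 0ℤ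

zero₁ : Coeffs₁
zero₁ _ = 0ℤ

_*₁_ : Coeffs₁ → Coeffs₁ → Coeffs₁
(f *₁ g) k = sumTo k (λ a → f a * g (k ∸ a))

prod₁ : List Coeffs₁ → Coeffs₁
prod₁ = foldr _*₁_ one₁

IsUnit₁ : Coeffs₁ → Set
IsUnit₁ u = IsPoly₁ u × (∃ λ v → IsPoly₁ v × ((u *₁ v) ≈₁ one₁))

Irreducible₁ : Coeffs₁ → Set
Irreducible₁ p =
  IsPoly₁ p × ¬ (p ≈₁ zero₁) × ¬ IsUnit₁ p ×
  (∀ a b → IsPoly₁ a → IsPoly₁ b → p ≈₁ (a *₁ b) → IsUnit₁ a ⊎' IsUnit₁ b)
  where
  open import Data.Sum renaming (_⊎_ to _⊎'_)

IsFactorization₁ : Coeffs₁ → List Coeffs₁ → Set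
IsFactorization₁ p L = All Irreducible₁ L × (prod₁ L ≈₁ p)

-- Bivariate polynomials over ℤ: coefficient of x^i y^j, finite support.

Coeffs₂ : Set
Coeffs₂ = ℕ → ℕ → ℤ

IsPoly₂ : Coeffs₂ → Set
IsPoly₂ f = ∃ λ N → ∀ i j → N ℕ.≤ i ℕ.+ j → f i j ≡ 0ℤ

_≈₂_ : Coeffs₂ → Coeffs₂ → Set
f ≈₂ g = ∀ i j → f i j ≡ g i j

one₂ : Coeffs₂
one₂ zero zero = 1ℤ
one₂ _    _    = 0ℤ

zero₂ : Coeffs₂
zero₂ _ _ = 0ℤ

_*₂_ : Coeffs₂ → Coeffs₂ → Coeffs₂
(f *₂ g) i j = sumTo i (λ a → sumTo j (λ b → f a b * g (i ∸ a) (j ∸ b)))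

prod₂ : List Coeffs₂ → Coeffs₂
prod₂ = foldr _*₂_ one₂

IsUnit₂ : Coeffs₂ → Set
IsUnit₂ u = IsPoly₂ u × (∃ λ v → IsPoly₂ v × ((u *₂ v) ≈₂ one₂))

Irreducible₂ : Coeffs₂ → Set
Irreducible₂ p =
  IsPoly₂ p × ¬ (p ≈₂ zero₂) × ¬ IsUnit₂ p ×
  (∀ a b → IsPoly₂ a → IsPoly₂ b → p ≈₂ (a *₂ b) → IsUnit₂ a ⊎' IsUnit₂ b)
  where
  open import Data.Sum renaming (_⊎_ to _⊎'_)

IsFactorization₂ : Coeffs₂ → List Coeffs₂ → Set
IsFactorization₂ p L = All Irreducible₂ L × (prod₂ L ≈₂ p)

-- specialization y := x :  P(x,x) has x^k-coefficient Σ_{i+j=k} p_{i,j}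
diag : Coeffs₂ → Coeffs₁
diag f k = sumTo k (λ i → f i (k ∸ i))

-- Generating polynomial of a binary string (false = 0, true = 1).
-- prefixPoints a b s lists (a_i, b_i) for i = 0..n, offset by (a, b).

prefixPoints : ℕ → ℕ → List Bool → List (ℕ × ℕ)
prefixPoints a b []          = (a , b) ∷ []
prefixPoints a b (false ∷ s) = (a , b) ∷ prefixPoints (suc a) b s
prefixPoints a b (true  ∷ s) = (a , b) ∷ prefixPoints a (suc b) s

countPt : ℕ → ℕ → List (ℕ × ℕ) → ℕ
countPt i j []             = 0
countPt i j ((a , b) ∷ ps) =
  (if (i ≡ᵇ a) ∧ (j ≡ᵇ b) then 1 else 0) ℕ.+ countPt i j ps

genPoly : List Bool → Coeffs₂
genPoly s i j = + countPt i j (prefixPoints 0 0 s)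

-- Setting y = x is a ring homomorphism ℤ[x,y] → ℤ[x]. Every point (a_i , b_i) of a binary string
-- lies on the line a + b = i, so P = P_s has total degree n = |s|, P(x,x) has degree n as well
-- (its coefficients are nonnegative and one on the top level is positive), and P(0,0) = 1.
-- In a factorization P = Q₁ ⋯ Q_k both degrees add up and deg Qᵢ(x,x) ≤ deg Qᵢ, so equality
-- holds for every factor. Hence if Qᵢ(x,x) is a unit then Qᵢ is a constant dividing P(0,0) = 1,
-- so the images of irreducible factors are non-units. As ℤ[x] is factorial (irreducibles are
-- prime, by Gauss's lemma and pseudo-division), a product of k non-units has at least k
-- irreducible factors.

module Submission where

open import Defs
open import Algebra.Bundles using (CommutativeRing)
open import Algebra.Structures using (IsCommutativeRing)
import Algebra.Solver.Ring.AlmostCommutativeRing as ACR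
open import Data.Bool using (Bool; true; false; T; _∧_; if_then_else_)
open import Data.Empty using (⊥)
open import Data.Integer as ℤ using (ℤ; +_; _+_; _*_; -_; 0ℤ; 1ℤ; _^_; ∣_∣)
import Data.Integer.Properties as ℤP
open import Data.Integer.Divisibility.Signed as ℤD using (divides; ∣ᵤ⇒∣; ∣⇒∣ᵤ)
  renaming (_∣_ to _∣ℤ_; _∣?_ to _∣ℤ?_)
open import Data.Integer.Tactic.RingSolver using (solve-∀)
open import Data.List using (List; []; _∷_; length; map)
open import Data.List.Membership.Propositional using (_∈_)
open import Data.List.Properties using (length-map)
open import Data.List.Relation.Unary.All as All using (All; []; _∷_)
open import Data.List.Relation.Unary.Any using (here; there)
open import Data.Maybe using (Maybe; just; nothing)
open import Data.Nat as ℕ using (ℕ; zero; suc; _∸_; _≡ᵇ_; _≤_; z≤n; s≤s; NonTrivial; nonTrivial⇒≢1)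
import Data.Nat.Properties as ℕP
import Data.Nat.Divisibility as ℕD
open import Data.Nat.Induction using (<-rec)
open import Data.Nat.ListAction using (product)
open import Data.Nat.Primality using (Prime; Irreducible; euclidsLemma; prime⇒nonZero; prime⇒nonTrivial; irreducible⇒prime)
open import Data.Nat.Primality.Factorisation using (factorise; PrimeFactorisation)
open import Data.Nat.Tactic.RingSolver using () renaming (solve-∀ to solve-ℕ)
open import Data.Product using (_,_; _×_; proj₁; proj₂; ∃; Σ)
open import Data.Sum using (_⊎_; inj₁; inj₂; [_,_])
import Data.Sum as Sum
open import Function using (_∘_)
open import Relation.Binary using (tri<; tri≈; tri>)
open import Relation.Binary.PropositionalEquality
  using (_≡_; _≢_; refl; sym; trans; cong; cong₂; subst; ≢-sym; module ≡-Reasoning)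
import Relation.Binary.Reasoning.Setoid as SetoidReasoning
open import Relation.Nullary using (¬_; Dec; yes; no; contradiction)

sumTo-cong≤ : ∀ n {f g : ℕ → ℤ} → (∀ i → i ℕ.≤ n → f i ≡ g i) → sumTo n f ≡ sumTo n g
sumTo-cong≤ zero    f≡g = f≡g 0 z≤n
sumTo-cong≤ (suc n) f≡g =
  cong₂ _+_ (sumTo-cong≤ n (λ i i≤n → f≡g i (ℕP.m≤n⇒m≤1+n i≤n))) (f≡g (suc n) ℕP.≤-refl)

sumTo-cong : ∀ n {f g : ℕ → ℤ} → (∀ i → f i ≡ g i) → sumTo n f ≡ sumTo n g
sumTo-cong n f≡g = sumTo-cong≤ n (λ i _ → f≡g i)

sumTo-distrib-+ : ∀ n (f g : ℕ → ℤ) → sumTo n (λ i → f i + g i) ≡ sumTo n f + sumTo n g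
sumTo-distrib-+ zero    f g = refl
sumTo-distrib-+ (suc n) f g =
  trans (cong (_+ (f (suc n) + g (suc n))) (sumTo-distrib-+ n f g))
        (interchange (sumTo n f) (sumTo n g) (f (suc n)) (g (suc n)))
  where
  interchange : ∀ a b c d → (a + b) + (c + d) ≡ (a + c) + (b + d)
  interchange = solve-∀

*-distribˡ-sumTo : ∀ n c (f : ℕ → ℤ) → c * sumTo n f ≡ sumTo n (λ i → c * f i)
*-distribˡ-sumTo zero    c f = refl
*-distribˡ-sumTo (suc n) c f =
  trans (ℤP.*-distribˡ-+ c (sumTo n f) (f (suc n))) (cong (_+ c * f (suc n)) (*-distribˡ-sumTo n c f))

*-distribʳ-sumTo : ∀ n c (f : ℕ → ℤ) → sumTo n f * c ≡ sumTo n (λ i → f i * c)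
*-distribʳ-sumTo n c f =
  trans (ℤP.*-comm (sumTo n f) c)
        (trans (*-distribˡ-sumTo n c f) (sumTo-cong n (λ i → ℤP.*-comm c (f i))))

sumTo-zero : ∀ n (f : ℕ → ℤ) → (∀ i → i ℕ.≤ n → f i ≡ 0ℤ) → sumTo n f ≡ 0ℤ
sumTo-zero zero    f f≡0 = f≡0 0 z≤n
sumTo-zero (suc n) f f≡0 =
  cong₂ _+_ (sumTo-zero n f (λ i i≤n → f≡0 i (ℕP.m≤n⇒m≤1+n i≤n))) (f≡0 (suc n) ℕP.≤-refl)

sumTo-single : ∀ n d (f : ℕ → ℤ) → d ℕ.≤ n → (∀ i → i ℕ.≤ n → i ≢ d → f i ≡ 0ℤ) →
               sumTo n f ≡ f d
sumTo-single zero    .zero f z≤n _   = refl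
sumTo-single (suc n) d     f d≤  off with d ℕP.≟ suc n
... | yes refl =
  trans (cong (_+ f (suc n)) (sumTo-zero n f (λ i i≤n → off i (ℕP.m≤n⇒m≤1+n i≤n) (ℕP.<⇒≢ (s≤s i≤n)))))
        (ℤP.+-identityˡ _)
... | no d≢ =
  trans (cong₂ _+_ (sumTo-single n d f (ℕP.≤-pred (ℕP.≤∧≢⇒< d≤ d≢)) (λ i i≤n → off i (ℕP.m≤n⇒m≤1+n i≤n)))
                   (off (suc n) ℕP.≤-refl (≢-sym d≢)))
        (ℤP.+-identityʳ _)

sumTo-unfoldˡ : ∀ n (f : ℕ → ℤ) → sumTo (suc n) f ≡ f 0 + sumTo n (λ i → f (suc i))
sumTo-unfoldˡ zero    f = refl
sumTo-unfoldˡ (suc n) f = trans (cong (_+ f (suc (suc n))) (sumTo-unfoldˡ n f)) (ℤP.+-assoc (f 0) _ _)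

sumTo-reverse : ∀ n (f : ℕ → ℤ) → sumTo n f ≡ sumTo n (λ i → f (n ∸ i))
sumTo-reverse zero    f = refl
sumTo-reverse (suc n) f =
  trans (cong (_+ f (suc n)) (sumTo-reverse n f))
        (trans (ℤP.+-comm _ (f (suc n))) (sym (sumTo-unfoldˡ n (λ i → f (suc n ∸ i)))))

sumTo-antidiagonal-comm : ∀ k (F : ℕ → ℕ → ℤ) →
  sumTo k (λ a → F a (k ∸ a)) ≡ sumTo k (λ a → F (k ∸ a) a)
sumTo-antidiagonal-comm k F =
  trans (sumTo-reverse k (λ a → F a (k ∸ a)))
        (sumTo-cong≤ k (λ a a≤k → cong (F (k ∸ a)) (ℕP.m∸[m∸n]≡n a≤k)))

-- Both sides sum H over the triangle { (b , c) | c ≤ b ≤ k }, by rows and by columns.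
sumTo-triangle : ∀ k (H : ℕ → ℕ → ℤ) →
  sumTo k (λ b → sumTo b (H b)) ≡ sumTo k (λ c → sumTo (k ∸ c) (λ t → H (c ℕ.+ t) c))
sumTo-triangle zero    H = refl
sumTo-triangle (suc k) H = begin
  sumTo k (λ b → sumTo b (H b)) + (sumTo k (H (suc k)) + H (suc k) (suc k))
    ≡⟨ cong (_+ (sumTo k (H (suc k)) + H (suc k) (suc k))) (sumTo-triangle k H) ⟩
  columns k + (sumTo k (H (suc k)) + H (suc k) (suc k))
    ≡⟨ sym (ℤP.+-assoc (columns k) (sumTo k (H (suc k))) (H (suc k) (suc k))) ⟩
  (columns k + sumTo k (H (suc k))) + H (suc k) (suc k)
    ≡⟨ cong₂ _+_ (sym (sumTo-distrib-+ k _ _)) (cong (λ z → H z (suc k)) (sym (ℕP.+-identityʳ (suc k)))) ⟩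
  sumTo k (λ c → column k c + H (suc k) c) + H (suc k ℕ.+ 0) (suc k)
    ≡⟨ cong₂ _+_ (sumTo-cong≤ k extend) (cong (λ m → sumTo m (λ t → H (suc k ℕ.+ t) (suc k))) (sym (ℕP.n∸n≡0 (suc k)))) ⟩
  columns (suc k) ∎
  where
  open ≡-Reasoning
  column : ℕ → ℕ → ℤ
  column m c = sumTo (m ∸ c) (λ t → H (c ℕ.+ t) c)
  columns : ℕ → ℤ
  columns m = sumTo m (column m)
  extend : ∀ c → c ℕ.≤ k → column k c + H (suc k) c ≡ column (suc k) c
  extend c c≤k rewrite ℕP.+-∸-assoc 1 c≤k =
    cong (_+_ (column k c)) (cong (λ z → H z c) (sym (trans (ℕP.+-suc c (k ∸ c)) (cong suc (ℕP.m+[n∸m]≡n c≤k)))))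

sumTo-triangle-antidiagonal : ∀ k (G : ℕ → ℕ → ℤ) →
  sumTo k (λ c → sumTo (k ∸ c) (G c)) ≡ sumTo k (λ s → sumTo s (λ t → G t (s ∸ t)))
sumTo-triangle-antidiagonal k G =
  sym (trans (sumTo-triangle k (λ s t → G t (s ∸ t)))
             (sumTo-cong k (λ c → sumTo-cong (k ∸ c) (λ t → cong (G c) (ℕP.m+n∸m≡n c t)))))

sumTo-swap : ∀ K (G : ℕ → ℕ → ℤ) →
  sumTo K (λ t → sumTo (K ∸ t) (G t)) ≡ sumTo K (λ b → sumTo (K ∸ b) (λ t → G t b))
sumTo-swap K G = begin
  sumTo K (λ t → sumTo (K ∸ t) (G t))
    ≡⟨ sumTo-triangle-antidiagonal K G ⟩
  sumTo K (λ s → sumTo s (λ t → G t (s ∸ t)))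
    ≡⟨ sumTo-cong K (λ s → sumTo-antidiagonal-comm s G) ⟩
  sumTo K (λ s → sumTo s (λ b → G (s ∸ b) b))
    ≡⟨ sumTo-triangle K (λ s b → G (s ∸ b) b) ⟩
  sumTo K (λ b → sumTo (K ∸ b) (λ t → G (b ℕ.+ t ∸ b) b))
    ≡⟨ sumTo-cong K (λ b → sumTo-cong (K ∸ b) (λ t → cong (λ z → G z b) (ℕP.m+n∸m≡n b t))) ⟩
  sumTo K (λ b → sumTo (K ∸ b) (λ t → G t b)) ∎
  where open ≡-Reasoning

sumTo-nonNegative : ∀ n (F : ℕ → ℤ) → (∀ a → 0ℤ ℤ.≤ F a) → 0ℤ ℤ.≤ sumTo n F
sumTo-nonNegative zero    F 0≤F = 0≤F 0
sumTo-nonNegative (suc n) F 0≤F = ℤP.+-mono-≤ (sumTo-nonNegative n F 0≤F) (0≤F (suc n))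

term≤sumTo : ∀ n (F : ℕ → ℤ) → (∀ a → 0ℤ ℤ.≤ F a) → ∀ i → i ℕ.≤ n → F i ℤ.≤ sumTo n F
term≤sumTo zero    F 0≤F .zero z≤n = ℤP.≤-refl
term≤sumTo (suc n) F 0≤F i    i≤1+n with i ℕP.≟ suc n
... | yes refl = ℤP.≤-trans (ℤP.≤-reflexive (sym (ℤP.+-identityˡ (F i))))
                            (ℤP.+-monoˡ-≤ (F i) (sumTo-nonNegative n F 0≤F))
... | no  i≢   = ℤP.≤-trans (term≤sumTo n F 0≤F i (ℕP.≤-pred (ℕP.≤∧≢⇒< i≤1+n i≢)))
                            (ℤP.≤-trans (ℤP.≤-reflexive (sym (ℤP.+-identityʳ _)))
                                        (ℤP.+-monoʳ-≤ (sumTo n F) (0≤F (suc n))))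

infixl 6 _+₁_
infix  8 -₁_

_+₁_ : Coeffs₁ → Coeffs₁ → Coeffs₁
(f +₁ g) k = f k + g k

-₁_ : Coeffs₁ → Coeffs₁
(-₁ f) k = - f k

const₁ : ℤ → Coeffs₁
const₁ c zero    = c
const₁ c (suc _) = 0ℤ

≈₁-refl : ∀ {f} → f ≈₁ f
≈₁-refl k = refl

≈₁-sym : ∀ {f g} → f ≈₁ g → g ≈₁ f
≈₁-sym f≈g k = sym (f≈g k)

≈₁-trans : ∀ {f g h} → f ≈₁ g → g ≈₁ h → f ≈₁ h
≈₁-trans f≈g g≈h k = trans (f≈g k) (g≈h k)

*₁-cong : ∀ {f f′ g g′} → f ≈₁ f′ → g ≈₁ g′ → (f *₁ g) ≈₁ (f′ *₁ g′)
*₁-cong f≈f′ g≈g′ k = sumTo-cong k (λ a → cong₂ _*_ (f≈f′ a) (g≈g′ (k ∸ a)))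

*₁-congˡ : ∀ f {g g′} → g ≈₁ g′ → (f *₁ g) ≈₁ (f *₁ g′)
*₁-congˡ f = *₁-cong {f} {f} ≈₁-refl

*₁-congʳ : ∀ g {f f′} → f ≈₁ f′ → (f *₁ g) ≈₁ (f′ *₁ g)
*₁-congʳ g f≈f′ = *₁-cong {g = g} {g′ = g} f≈f′ ≈₁-refl

*₁-comm : ∀ f g → (f *₁ g) ≈₁ (g *₁ f)
*₁-comm f g k =
  trans (sumTo-antidiagonal-comm k (λ a b → f a * g b)) (sumTo-cong k (λ a → ℤP.*-comm (f (k ∸ a)) (g a)))

*₁-assoc : ∀ f g h → ((f *₁ g) *₁ h) ≈₁ (f *₁ (g *₁ h))
*₁-assoc f g h k = begin
  sumTo k (λ b → sumTo b (λ c → f c * g (b ∸ c)) * h (k ∸ b))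
    ≡⟨ sumTo-cong k (λ b → *-distribʳ-sumTo b (h (k ∸ b)) _) ⟩
  sumTo k (λ b → sumTo b (λ c → f c * g (b ∸ c) * h (k ∸ b)))
    ≡⟨ sumTo-triangle k (λ b c → f c * g (b ∸ c) * h (k ∸ b)) ⟩
  sumTo k (λ c → sumTo (k ∸ c) (λ t → f c * g (c ℕ.+ t ∸ c) * h (k ∸ (c ℕ.+ t))))
    ≡⟨ sumTo-cong k (λ c → sumTo-cong (k ∸ c) (λ t →
         trans (cong₂ (λ u v → f c * g u * h v) (ℕP.m+n∸m≡n c t) (sym (ℕP.∸-+-assoc k c t)))
               (ℤP.*-assoc (f c) (g t) (h (k ∸ c ∸ t))))) ⟩
  sumTo k (λ c → sumTo (k ∸ c) (λ t → f c * (g t * h (k ∸ c ∸ t))))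
    ≡⟨ sumTo-cong k (λ c → sym (*-distribˡ-sumTo (k ∸ c) (f c) _)) ⟩
  sumTo k (λ c → f c * sumTo (k ∸ c) (λ t → g t * h (k ∸ c ∸ t))) ∎
  where
  open ≡-Reasoning

const₁-*₁ : ∀ c f → (const₁ c *₁ f) ≈₁ (λ k → c * f k)
const₁-*₁ c f k = sumTo-single k 0 (λ a → const₁ c a * f (k ∸ a)) z≤n
  (λ { zero _ 0≢0 → contradiction refl 0≢0 ; (suc i) _ _ → refl })

const₁-*₁-const₁ : ∀ a b → (const₁ a *₁ const₁ b) ≈₁ const₁ (a * b)
const₁-*₁-const₁ a b zero    = refl
const₁-*₁-const₁ a b (suc k) = trans (const₁-*₁ a (const₁ b) (suc k)) (ℤP.*-zeroʳ a)

*₁-identityˡ : ∀ f → (one₁ *₁ f) ≈₁ f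
*₁-identityˡ f k =
  trans (*₁-congʳ f {one₁} {const₁ 1ℤ} (λ { zero → refl ; (suc _) → refl }) k)
        (trans (const₁-*₁ 1ℤ f k) (ℤP.*-identityˡ (f k)))

*₁-distribˡ-+₁ : ∀ f g h → (f *₁ (g +₁ h)) ≈₁ ((f *₁ g) +₁ (f *₁ h))
*₁-distribˡ-+₁ f g h k =
  trans (sumTo-cong k (λ a → ℤP.*-distribˡ-+ (f a) (g (k ∸ a)) (h (k ∸ a)))) (sumTo-distrib-+ k _ _)

ℤ[x]-isCommutativeRing : IsCommutativeRing _≈₁_ _+₁_ _*₁_ -₁_ zero₁ one₁
ℤ[x]-isCommutativeRing = record
  { isRing = record
    { +-isAbelianGroup = record
      { isGroup = record
        { isMonoid = record
          { isSemigroup = record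
            { isMagma = record
              { isEquivalence = record { refl = ≈₁-refl ; sym = ≈₁-sym ; trans = ≈₁-trans }
              ; ∙-cong = λ f≈f′ g≈g′ k → cong₂ _+_ (f≈f′ k) (g≈g′ k) }
            ; assoc = λ f g h k → ℤP.+-assoc (f k) (g k) (h k) }
          ; identity = (λ f k → ℤP.+-identityˡ (f k)) , (λ f k → ℤP.+-identityʳ (f k)) }
        ; inverse = (λ f k → ℤP.+-inverseˡ (f k)) , (λ f k → ℤP.+-inverseʳ (f k))
        ; ⁻¹-cong = λ f≈g k → cong -_ (f≈g k) }
      ; comm = λ f g k → ℤP.+-comm (f k) (g k) }
    ; *-cong = *₁-cong
    ; *-assoc = *₁-assoc
    ; *-identity = *₁-identityˡ , (λ f → ≈₁-trans (*₁-comm f one₁) (*₁-identityˡ f))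
    ; distrib = *₁-distribˡ-+₁ , distribʳ }
  ; *-comm = *₁-comm }
  where
  distribʳ : ∀ f g h → ((g +₁ h) *₁ f) ≈₁ ((g *₁ f) +₁ (h *₁ f))
  distribʳ f g h = ≈₁-trans (*₁-comm (g +₁ h) f)
    (≈₁-trans (*₁-distribˡ-+₁ f g h) (λ k → cong₂ _+_ (*₁-comm f g k) (*₁-comm f h k)))

ℤ[x] : CommutativeRing _ _
ℤ[x] = record { isCommutativeRing = ℤ[x]-isCommutativeRing }

const₁-homomorphism : ACR._-Raw-AlmostCommutative⟶_ ℤ.+-*-rawRing (ACR.fromCommutativeRing ℤ[x])
const₁-homomorphism = record
  { ⟦_⟧    = const₁
  ; +-homo = λ a b → λ { zero → refl ; (suc k) → refl }
  ; *-homo = λ a b → ≈₁-sym (const₁-*₁-const₁ a b)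
  ; -‿homo = λ a → λ { zero → refl ; (suc k) → refl }
  ; 0-homo = λ { zero → refl ; (suc k) → refl }
  ; 1-homo = λ { zero → refl ; (suc k) → refl } }

const₁-≟ : ∀ a b → Maybe (ACR.Induced-equivalence const₁-homomorphism a b)
const₁-≟ a b with a ℤP.≟ b
... | yes refl = just ≈₁-refl
... | no _     = nothing

open import Algebra.Solver.Ring ℤ.+-*-rawRing (ACR.fromCommutativeRing ℤ[x]) const₁-homomorphism const₁-≟
  using (solve; _:+_; _:*_; :-_; _:=_; con)

module ≈₁-Reasoning = SetoidReasoning (CommutativeRing.setoid ℤ[x])

Bounded₁ : Coeffs₁ → ℕ → Set
Bounded₁ f N = ∀ k → N ℕ.≤ k → f k ≡ 0ℤ

HasDegree : Coeffs₁ → ℕ → Set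
HasDegree f d = f d ≢ 0ℤ × (∀ k → d ℕ.< k → f k ≡ 0ℤ)

IsPoly₁-resp-≈ : ∀ {f g} → f ≈₁ g → IsPoly₁ f → IsPoly₁ g
IsPoly₁-resp-≈ f≈g (N , f≡0) = N , λ k N≤k → trans (sym (f≈g k)) (f≡0 k N≤k)

IsPoly₁-+ : ∀ {f g} → IsPoly₁ f → IsPoly₁ g → IsPoly₁ (f +₁ g)
IsPoly₁-+ (N , f≡0) (M , g≡0) = N ℕ.+ M , λ k le →
  cong₂ _+_ (f≡0 k (ℕP.≤-trans (ℕP.m≤m+n N M) le)) (g≡0 k (ℕP.≤-trans (ℕP.m≤n+m M N) le))

IsPoly₁-neg : ∀ {f} → IsPoly₁ f → IsPoly₁ (-₁ f)
IsPoly₁-neg (N , f≡0) = N , λ k le → cong -_ (f≡0 k le)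

IsPoly₁-const : ∀ c → IsPoly₁ (const₁ c)
IsPoly₁-const c = 1 , λ { (suc k) _ → refl }

IsPoly₁-one : IsPoly₁ one₁
IsPoly₁-one = 1 , λ { (suc k) _ → refl }

IsPoly₁-zero : IsPoly₁ zero₁
IsPoly₁-zero = 0 , λ k _ → refl

Bounded₁-* : ∀ {f g N M} → Bounded₁ f N → Bounded₁ g M → Bounded₁ (f *₁ g) (N ℕ.+ M)
Bounded₁-* {f} {g} {N} {M} f≡0 g≡0 k N+M≤k = sumTo-zero k _ term
  where
  term : ∀ a → a ℕ.≤ k → f a * g (k ∸ a) ≡ 0ℤ
  term a a≤k with N ℕP.≤? a
  ... | yes N≤a = cong (_* g (k ∸ a)) (f≡0 a N≤a)
  ... | no  N≰a = trans (cong (f a *_) (g≡0 (k ∸ a) M≤k∸a)) (ℤP.*-zeroʳ (f a))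
    where
    M≤k∸a : M ℕ.≤ k ∸ a
    M≤k∸a = ℕP.+-cancelʳ-≤ a M (k ∸ a) (begin
      M ℕ.+ a ≤⟨ ℕP.+-monoʳ-≤ M (ℕP.<⇒≤ (ℕP.≰⇒> N≰a)) ⟩
      M ℕ.+ N ≡⟨ ℕP.+-comm M N ⟩
      N ℕ.+ M ≤⟨ N+M≤k ⟩
      k       ≡⟨ ℕP.m∸n+n≡m a≤k ⟨
      k ∸ a ℕ.+ a ∎)
      where open ℕP.≤-Reasoning

IsPoly₁-* : ∀ {f g} → IsPoly₁ f → IsPoly₁ g → IsPoly₁ (f *₁ g)
IsPoly₁-* (N , f≡0) (M , g≡0) = N ℕ.+ M , Bounded₁-* f≡0 g≡0

Bounded₁-pred : ∀ {f N} → Bounded₁ f (suc N) → f N ≡ 0ℤ → Bounded₁ f N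
Bounded₁-pred {N = N} f≡0 fN≡0 k N≤k with N ℕP.≟ k
... | yes refl = fN≡0
... | no  N≢k  = f≡0 k (ℕP.≤∧≢⇒< N≤k N≢k)

zero-or-degree< : ∀ f N → Bounded₁ f N → f ≈₁ zero₁ ⊎ ∃ λ d → HasDegree f d × d ℕ.< N
zero-or-degree< f zero    f≡0 = inj₁ (λ k → f≡0 k z≤n)
zero-or-degree< f (suc N) f≡0 with f N ℤP.≟ 0ℤ
... | no fN≢0  = inj₂ (N , (fN≢0 , f≡0) , ℕP.≤-refl)
... | yes fN≡0 with zero-or-degree< f N (Bounded₁-pred f≡0 fN≡0)
...   | inj₁ f≈0            = inj₁ f≈0
...   | inj₂ (d , hd , d<N) = inj₂ (d , hd , ℕP.m≤n⇒m≤1+n d<N)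

zero-or-degree : ∀ {f} → IsPoly₁ f → f ≈₁ zero₁ ⊎ ∃ (HasDegree f)
zero-or-degree {f} (N , f≡0) with zero-or-degree< f N f≡0
... | inj₁ f≈0          = inj₁ f≈0
... | inj₂ (d , hd , _) = inj₂ (d , hd)

≉0⇒degree : ∀ {f} → IsPoly₁ f → ¬ f ≈₁ zero₁ → ∃ (HasDegree f)
≉0⇒degree pf f≉0 with zero-or-degree pf
... | inj₁ f≈0 = contradiction f≈0 f≉0
... | inj₂ hd  = hd

HasDegree⇒≉0 : ∀ {f d} → HasDegree f d → ¬ f ≈₁ zero₁
HasDegree⇒≉0 (fd≢0 , _) f≈0 = fd≢0 (f≈0 _)

HasDegree-unique : ∀ {f d e} → HasDegree f d → HasDegree f e → d ≡ e
HasDegree-unique {d = d} {e} (fd≢0 , above-d) (fe≢0 , above-e) with ℕP.<-cmp d e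
... | tri< d<e _ _ = contradiction (above-d e d<e) fe≢0
... | tri≈ _ d≡e _ = d≡e
... | tri> _ _ e<d = contradiction (above-e d e<d) fd≢0

Bounded₁⇒degree< : ∀ {f N d} → Bounded₁ f N → HasDegree f d → d ℕ.< N
Bounded₁⇒degree< {N = N} {d} f≡0 (fd≢0 , _) with d ℕP.<? N
... | yes d<N = d<N
... | no  d≮N = contradiction (f≡0 d (ℕP.≮⇒≥ d≮N)) fd≢0

HasDegree-resp-≈ : ∀ {f g d} → f ≈₁ g → HasDegree f d → HasDegree g d
HasDegree-resp-≈ f≈g (fd≢0 , above) = (λ gd≡0 → fd≢0 (trans (f≈g _) gd≡0)) , λ k lt → trans (sym (f≈g k)) (above k lt)

HasDegree-one : HasDegree one₁ 0
HasDegree-one = (λ ()) , λ { (suc k) _ → refl }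

HasDegree0⇒≈const : ∀ {f} → HasDegree f 0 → f ≈₁ const₁ (f 0)
HasDegree0⇒≈const _           zero    = refl
HasDegree0⇒≈const (_ , above) (suc k) = above (suc k) (s≤s z≤n)

-- The product of the leading coefficients is the only term of degree d + e.
HasDegree-* : ∀ {f g d e} → HasDegree f d → HasDegree g e → HasDegree (f *₁ g) (d ℕ.+ e)
HasDegree-* {f} {g} {d} {e} (fd≢0 , f-above) (ge≢0 , g-above) =
  (λ eq → fd*ge≢0 (trans (sym leading) eq)) , above
  where
  fd*ge≢0 : f d * g e ≢ 0ℤ
  fd*ge≢0 eq with ℤP.i*j≡0⇒i≡0∨j≡0 (f d) eq
  ... | inj₁ fd≡0 = fd≢0 fd≡0
  ... | inj₂ ge≡0 = ge≢0 ge≡0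
  vanishing : ∀ {k} a → d ℕ.< a ⊎ a ℕ.+ e ℕ.< k → f a * g (k ∸ a) ≡ 0ℤ
  vanishing {k} a (inj₁ d<a)   = cong (_* g (k ∸ a)) (f-above a d<a)
  vanishing {k} a (inj₂ a+e<k) = trans (cong (f a *_) (g-above (k ∸ a) e<k∸a)) (ℤP.*-zeroʳ (f a))
    where
    e<k∸a : e ℕ.< k ∸ a
    e<k∸a = ℕP.m+n≤o⇒m≤o∸n (suc e) (subst (ℕ._≤ k) (cong suc (ℕP.+-comm a e)) a+e<k)
  above : ∀ k → d ℕ.+ e ℕ.< k → (f *₁ g) k ≡ 0ℤ
  above k d+e<k = sumTo-zero k _ λ a _ → vanishing a (case a)
    where
    case : ∀ a → d ℕ.< a ⊎ a ℕ.+ e ℕ.< k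
    case a with d ℕP.<? a
    ... | yes d<a = inj₁ d<a
    ... | no  d≮a = inj₂ (ℕP.≤-<-trans (ℕP.+-monoˡ-≤ e (ℕP.≮⇒≥ d≮a)) d+e<k)
  leading : (f *₁ g) (d ℕ.+ e) ≡ f d * g e
  leading = trans (sumTo-single (d ℕ.+ e) d _ (ℕP.m≤m+n d e) (λ a _ a≢d → vanishing a (case a a≢d)))
                  (cong (λ z → f d * g z) (ℕP.m+n∸m≡n d e))
    where
    case : ∀ a → a ≢ d → d ℕ.< a ⊎ a ℕ.+ e ℕ.< d ℕ.+ e
    case a a≢d with ℕP.<-cmp a d
    ... | tri< a<d _ _ = inj₂ (ℕP.+-monoˡ-< e a<d)
    ... | tri≈ _ a≡d _ = contradiction a≡d a≢d
    ... | tri> _ _ d<a = inj₁ d<a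

*₁-zeroˡ : ∀ {f} g → f ≈₁ zero₁ → (f *₁ g) ≈₁ zero₁
*₁-zeroˡ g f≈0 k = sumTo-zero k _ (λ a _ → cong (_* g (k ∸ a)) (f≈0 a))

*₁-≉0 : ∀ {f g} → IsPoly₁ f → IsPoly₁ g → ¬ f ≈₁ zero₁ → ¬ g ≈₁ zero₁ → ¬ (f *₁ g) ≈₁ zero₁
*₁-≉0 pf pg f≉0 g≉0 with ≉0⇒degree pf f≉0 | ≉0⇒degree pg g≉0
... | _ , hd | _ , he = HasDegree⇒≉0 (HasDegree-* hd he)

*₁-cancelˡ : ∀ {p f g} → IsPoly₁ p → ¬ p ≈₁ zero₁ → IsPoly₁ f → IsPoly₁ g →
             (p *₁ f) ≈₁ (p *₁ g) → f ≈₁ g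
*₁-cancelˡ {p} {f} {g} pp p≉0 pf pg pf≈pg k =
  ℤP.i-j≡0⇒i≡j (f k) (g k) (f-g≈0 k)
  where
  p*[f-g]≈0 : (p *₁ (f +₁ -₁ g)) ≈₁ zero₁
  p*[f-g]≈0 k = begin
    (p *₁ (f +₁ -₁ g)) k        ≡⟨ solve 3 (λ p f g → p :* (f :+ :- g) := p :* f :+ :- (p :* g)) ≈₁-refl p f g k ⟩
    (p *₁ f) k + - (p *₁ g) k   ≡⟨ cong (λ t → t + - (p *₁ g) k) (pf≈pg k) ⟩
    (p *₁ g) k + - (p *₁ g) k   ≡⟨ ℤP.+-inverseʳ ((p *₁ g) k) ⟩
    0ℤ                          ∎
    where open ≡-Reasoning
  f-g≈0 : (f +₁ -₁ g) ≈₁ zero₁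
  f-g≈0 with zero-or-degree (IsPoly₁-+ pf (IsPoly₁-neg pg))
  ... | inj₁ f-g≈0 = f-g≈0
  ... | inj₂ (_ , hd) = contradiction p*[f-g]≈0 (*₁-≉0 pp (IsPoly₁-+ pf (IsPoly₁-neg pg)) p≉0 (HasDegree⇒≉0 hd))

*₁≈one₁⇒≉0 : ∀ {f g} → (f *₁ g) ≈₁ one₁ → ¬ f ≈₁ zero₁
*₁≈one₁⇒≉0 {f} {g} fg≈1 f≈0 = contradiction (trans (sym (fg≈1 0)) (cong (_* g 0) (f≈0 0))) λ ()

IsUnit₁-degree : ∀ {u} → IsUnit₁ u → HasDegree u 0
IsUnit₁-degree {u} (pu , v , pv , uv≈1) = subst (HasDegree u) d≡0 (proj₂ du)
  where
  du = ≉0⇒degree pu (*₁≈one₁⇒≉0 {g = v} uv≈1)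
  dv = ≉0⇒degree pv (*₁≈one₁⇒≉0 {g = u} (≈₁-trans (*₁-comm v u) uv≈1))
  d≡0 : proj₁ du ≡ 0
  d≡0 = ℕP.m+n≡0⇒m≡0 (proj₁ du)
          (HasDegree-unique (HasDegree-resp-≈ uv≈1 (HasDegree-* (proj₂ du) (proj₂ dv))) HasDegree-one)

IsUnit₁-∣const∣ : ∀ {u} → IsUnit₁ u → ∣ u 0 ∣ ≡ 1
IsUnit₁-∣const∣ {u} (_ , v , _ , uv≈1) =
  ℕP.m*n≡1⇒m≡1 ∣ u 0 ∣ ∣ v 0 ∣ (trans (sym (ℤP.abs-* (u 0) (v 0))) (cong ∣_∣ (uv≈1 0)))

IsUnit₁⇒≈const : ∀ {u} → IsUnit₁ u → u ≈₁ const₁ (u 0)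
IsUnit₁⇒≈const = HasDegree0⇒≈const ∘ IsUnit₁-degree

∣i∣≡1⇒i*i≡1 : ∀ i → ∣ i ∣ ≡ 1 → i * i ≡ 1ℤ
∣i∣≡1⇒i*i≡1 (+ .1)          refl = refl
∣i∣≡1⇒i*i≡1 (ℤ.-[1+ zero ]) refl = refl

∣i∣≡1⇒i≢0 : ∀ {i} → ∣ i ∣ ≡ 1 → i ≢ 0ℤ
∣i∣≡1⇒i≢0 ∣i∣≡1 i≡0 = ℕP.1+n≢0 (trans (sym ∣i∣≡1) (cong ∣_∣ i≡0))

const₁-IsUnit₁ : ∀ {c} → ∣ c ∣ ≡ 1 → IsUnit₁ (const₁ c)
const₁-IsUnit₁ {c} ∣c∣≡1 = IsPoly₁-const c , const₁ c , IsPoly₁-const c , λ k → trans (const₁-*₁ c (const₁ c) k) (c*c k)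
  where
  c*c : ∀ k → c * const₁ c k ≡ one₁ k
  c*c zero    = ∣i∣≡1⇒i*i≡1 c ∣c∣≡1
  c*c (suc k) = ℤP.*-zeroʳ c

IsUnit₁-resp-≈ : ∀ {u u′} → u ≈₁ u′ → IsUnit₁ u → IsUnit₁ u′
IsUnit₁-resp-≈ u≈u′ (pu , v , pv , uv≈1) = IsPoly₁-resp-≈ u≈u′ pu , v , pv , ≈₁-trans (*₁-congʳ v (≈₁-sym u≈u′)) uv≈1

infixr 7 _·₁_

_·₁_ : ℤ → Coeffs₁ → Coeffs₁
c ·₁ f = const₁ c *₁ f

·₁-assoc : ∀ c d f → (c ·₁ (d ·₁ f)) ≈₁ ((c * d) ·₁ f)
·₁-assoc c d f k = begin
  (c ·₁ (d ·₁ f)) k  ≡⟨ const₁-*₁ c (d ·₁ f) k ⟩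
  c * (d ·₁ f) k     ≡⟨ cong (c *_) (const₁-*₁ d f k) ⟩
  c * (d * f k)      ≡⟨ ℤP.*-assoc c d (f k) ⟨
  c * d * f k        ≡⟨ const₁-*₁ (c * d) f k ⟨
  ((c * d) ·₁ f) k   ∎
  where open ≡-Reasoning

·₁-identityˡ : ∀ f → (1ℤ ·₁ f) ≈₁ f
·₁-identityˡ f k = trans (const₁-*₁ 1ℤ f k) (ℤP.*-identityˡ (f k))

·₁-congˡ : ∀ c {f g} → f ≈₁ g → (c ·₁ f) ≈₁ (c ·₁ g)
·₁-congˡ c = *₁-congˡ (const₁ c)

·₁-*₁-commute : ∀ c f g → (f *₁ (c ·₁ g)) ≈₁ (c ·₁ (f *₁ g))
·₁-*₁-commute c f g = solve 3 (λ C f g → f :* (C :* g) := C :* (f :* g)) ≈₁-refl (const₁ c) f g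

·₁-cancel : ∀ {c f g} → c ≢ 0ℤ → (c ·₁ f) ≈₁ (c ·₁ g) → f ≈₁ g
·₁-cancel {c} {f} {g} c≢0 cf≈cg k =
  ℤP.*-cancelˡ-≡ c (f k) (g k) {{ℤ.≢-nonZero c≢0}} (trans (sym (const₁-*₁ c f k)) (trans (cf≈cg k) (const₁-*₁ c g k)))

·₁-unit-involutive : ∀ {s} f → ∣ s ∣ ≡ 1 → (s ·₁ (s ·₁ f)) ≈₁ f
·₁-unit-involutive {s} f ∣s∣≡1 =
  ≈₁-trans (·₁-assoc s s f) (≈₁-trans (λ k → cong (λ z → (z ·₁ f) k) (∣i∣≡1⇒i*i≡1 s ∣s∣≡1)) (·₁-identityˡ f))

IsPoly₁-·₁ : ∀ c {f} → IsPoly₁ f → IsPoly₁ (c ·₁ f)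
IsPoly₁-·₁ c = IsPoly₁-* (IsPoly₁-const c)

-- Gauss's lemma

∣-sumTo : ∀ {d} n (F : ℕ → ℤ) → (∀ a → a ℕ.≤ n → d ∣ℤ F a) → d ∣ℤ sumTo n F
∣-sumTo zero    F d∣F = d∣F 0 z≤n
∣-sumTo (suc n) F d∣F = ℤD.∣m∣n⇒∣m+n (∣-sumTo n F (λ a a≤n → d∣F a (ℕP.m≤n⇒m≤1+n a≤n))) (d∣F (suc n) ℕP.≤-refl)

∣-sumTo-single : ∀ {d} n i (F : ℕ → ℤ) → i ℕ.≤ n → (∀ a → a ℕ.≤ n → a ≢ i → d ∣ℤ F a) →
                 d ∣ℤ sumTo n F → d ∣ℤ F i
∣-sumTo-single zero    .zero F z≤n _      d∣ΣF = d∣ΣF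
∣-sumTo-single (suc n) i     F i≤  d∣rest d∣ΣF with i ℕP.≟ suc n
... | yes refl = ℤD.∣m+n∣m⇒∣n d∣ΣF (∣-sumTo n F (λ a a≤n → d∣rest a (ℕP.m≤n⇒m≤1+n a≤n) (ℕP.<⇒≢ (s≤s a≤n))))
... | no  i≢   = ∣-sumTo-single n i F (ℕP.≤-pred (ℕP.≤∧≢⇒< i≤ i≢)) (λ a a≤n → d∣rest a (ℕP.m≤n⇒m≤1+n a≤n))
                   (ℤD.∣m+n∣n⇒∣m d∣ΣF (d∣rest (suc n) ℕP.≤-refl (≢-sym i≢)))

prime-∣-* : ∀ {q} → Prime q → ∀ a b → + q ∣ℤ a * b → + q ∣ℤ a ⊎ + q ∣ℤ b
prime-∣-* {q} pq a b q∣ab with euclidsLemma ∣ a ∣ ∣ b ∣ pq (ℕD.∣-trans (∣⇒∣ᵤ q∣ab) (ℕD.∣-reflexive (ℤP.abs-* a b)))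
... | inj₁ q∣a = inj₁ (∣ᵤ⇒∣ q∣a)
... | inj₂ q∣b = inj₂ (∣ᵤ⇒∣ q∣b)

prime≢0 : ∀ {q} → Prime q → + q ≢ 0ℤ
prime≢0 {zero}  pq refl with prime⇒nonZero pq
... | ()

all⊎least-counterexample : ∀ (P : ℕ → Set) → (∀ k → Dec (P k)) → ∀ N → (∀ k → N ℕ.≤ k → P k) →
  (∀ k → P k) ⊎ ∃ λ i → ¬ P i × (∀ a → a ℕ.< i → P a)
all⊎least-counterexample P P? zero    above = inj₁ (λ k → above k z≤n)
all⊎least-counterexample P P? (suc N) above with P? 0
... | no ¬P0 = inj₂ (0 , ¬P0 , λ a ())
... | yes P0 with all⊎least-counterexample (P ∘ suc) (P? ∘ suc) N (λ k N≤k → above (suc k) (s≤s N≤k))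
... | inj₁ all = inj₁ λ { zero → P0 ; (suc k) → all k }
... | inj₂ (i , ¬Pi , below) = inj₂ (suc i , ¬Pi , λ { zero _ → P0 ; (suc a) (s≤s a<i) → below a a<i })

DividesCoeffs : ℕ → Coeffs₁ → Set
DividesCoeffs q f = ∀ k → + q ∣ℤ f k

-- If q first misses a coefficient of f at index i and of g at index j, it misses exactly one
-- term of the coefficient of x^(i+j) in f g.
gauss-lemma : ∀ {q f g} → Prime q → IsPoly₁ f → IsPoly₁ g →
              DividesCoeffs q (f *₁ g) → DividesCoeffs q f ⊎ DividesCoeffs q g
gauss-lemma {q} {f} {g} pq pf pg q∣fg with least-miss f pf | least-miss g pg
  where
  least-miss : ∀ h → IsPoly₁ h → DividesCoeffs q h ⊎ ∃ λ i → ¬ + q ∣ℤ h i × (∀ a → a ℕ.< i → + q ∣ℤ h a)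
  least-miss h (N , h≡0) = all⊎least-counterexample (λ k → + q ∣ℤ h k) (λ k → + q ∣ℤ? h k) N
    (λ k N≤k → subst (+ q ∣ℤ_) (sym (h≡0 k N≤k)) (divides 0ℤ refl))
... | inj₁ q∣f | _       = inj₁ q∣f
... | inj₂ _   | inj₁ q∣g = inj₂ q∣g
... | inj₂ (i , q∤fi , q∣f<i) | inj₂ (j , q∤gj , q∣g<j)
  with prime-∣-* pq (f i) (g j) (subst (+ q ∣ℤ_) (cong (λ z → f i * g z) (ℕP.m+n∸m≡n i j))
         (∣-sumTo-single (i ℕ.+ j) i _ (ℕP.m≤m+n i j) other-terms (q∣fg (i ℕ.+ j))))
  where
  other-terms : ∀ a → a ℕ.≤ i ℕ.+ j → a ≢ i → + q ∣ℤ f a * g (i ℕ.+ j ∸ a)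
  other-terms a a≤i+j a≢i with ℕP.<-cmp a i
  ... | tri< a<i _ _ = ℤD.∣m⇒∣m*n (g (i ℕ.+ j ∸ a)) (q∣f<i a a<i)
  ... | tri≈ _ a≡i _ = contradiction a≡i a≢i
  ... | tri> _ _ i<a = ℤD.∣n⇒∣m*n (f a) (q∣g<j _ (ℕP.+-cancelʳ-< a (i ℕ.+ j ∸ a) j (begin-strict
    i ℕ.+ j ∸ a ℕ.+ a ≡⟨ ℕP.m∸n+n≡m a≤i+j ⟩
    i ℕ.+ j           ≡⟨ ℕP.+-comm i j ⟩
    j ℕ.+ i           <⟨ ℕP.+-monoʳ-< j i<a ⟩
    j ℕ.+ a           ∎)))
    where open ℕP.≤-Reasoning
... | inj₁ q∣fi = contradiction q∣fi q∤fi
... | inj₂ q∣gj = contradiction q∣gj q∤gj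

DividesCoeffs⇒≈·₁ : ∀ {q f} → Prime q → IsPoly₁ f → DividesCoeffs q f →
                         Σ Coeffs₁ λ f′ → IsPoly₁ f′ × f ≈₁ (+ q ·₁ f′)
DividesCoeffs⇒≈·₁ {q} {f} pq (N , f≡0) q∣f = f′ , (N , f′≡0) , f≈qf′
  where
  f′ : Coeffs₁
  f′ k = _∣ℤ_.quotient (q∣f k)
  f≈qf′ : f ≈₁ (+ q ·₁ f′)
  f≈qf′ k = trans (_∣ℤ_.equality (q∣f k)) (trans (ℤP.*-comm (f′ k) (+ q)) (sym (const₁-*₁ (+ q) f′ k)))
  f′≡0 : Bounded₁ f′ N
  f′≡0 k N≤k with ℤP.i*j≡0⇒i≡0∨j≡0 (f′ k) (trans (sym (_∣ℤ_.equality (q∣f k))) (f≡0 k N≤k))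
  ... | inj₁ f′k≡0 = f′k≡0
  ... | inj₂ q≡0   = contradiction q≡0 (prime≢0 pq)

prodℤ : List ℕ → ℤ
prodℤ []       = 1ℤ
prodℤ (q ∷ qs) = + q * prodℤ qs

prodℤ≢0 : ∀ {qs} → All Prime qs → prodℤ qs ≢ 0ℤ
prodℤ≢0 {q ∷ qs} (pq ∷ pqs) eq with ℤP.i*j≡0⇒i≡0∨j≡0 (+ q) eq
... | inj₁ q≡0  = prime≢0 pq q≡0
... | inj₂ qs≡0 = prodℤ≢0 pqs qs≡0

i≡±∣i∣ : ∀ c → ∃ λ s → ∣ s ∣ ≡ 1 × c ≡ s * + ∣ c ∣
i≡±∣i∣ (+ n)      = 1ℤ , refl , sym (ℤP.*-identityˡ (+ n))
i≡±∣i∣ ℤ.-[1+ n ] = ℤ.-[1+ 0 ] , refl , cong ℤ.-[1+_] (sym (ℕP.+-identityʳ n))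

i≡±∏primes : ∀ c → c ≢ 0ℤ → ∃ λ s → Σ (List ℕ) λ qs → ∣ s ∣ ≡ 1 × All Prime qs × c ≡ s * prodℤ qs
i≡±∏primes c c≢0 with i≡±∣i∣ c
... | s , ∣s∣≡1 , c≡s∣c∣ = s , F.factors , ∣s∣≡1 , F.factorsPrime ,
  trans c≡s∣c∣ (cong (s *_) (trans (cong +_ F.isFactorisation) (+product≡prodℤ F.factors)))
  where
  module F = PrimeFactorisation (factorise ∣ c ∣ {{ℤ.≢-nonZero c≢0}})
  +product≡prodℤ : ∀ qs → + product qs ≡ prodℤ qs
  +product≡prodℤ []       = refl
  +product≡prodℤ (q ∷ qs) = trans (ℤP.pos-* q _) (cong (+ q *_) (+product≡prodℤ qs))

-- If c h = a b, Gauss's lemma lets us divide the prime factors of c out of a or b one at a time;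
-- the sign of c ends up in b′.
record Split (h a : Coeffs₁) : Set where
  field
    primes       : List ℕ
    primes-prime : All Prime primes
    a′ b′        : Coeffs₁
    a′-poly      : IsPoly₁ a′
    b′-poly      : IsPoly₁ b′
    a≈           : a ≈₁ (prodℤ primes ·₁ a′)
    h≈           : h ≈₁ (a′ *₁ b′)

prime-split : ∀ qs → All Prime qs → ∀ {h a b} → IsPoly₁ a → IsPoly₁ b →
              (prodℤ qs ·₁ h) ≈₁ (a *₁ b) → Split h a
prime-split [] [] {h} {a} {b} pa pb h≈ab = record
  { primes = [] ; primes-prime = [] ; a′ = a ; b′ = b ; a′-poly = pa ; b′-poly = pb
  ; a≈ = ≈₁-sym (·₁-identityˡ a) ; h≈ = ≈₁-trans (≈₁-sym (·₁-identityˡ h)) h≈ab }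
prime-split (q ∷ qs) (pq ∷ pqs) {h} {a} {b} pa pb qPh≈ab = split-off-q (gauss-lemma pq pa pb q∣ab)
  where
  rearrange : ∀ x y z → x * y * z ≡ y * z * x
  rearrange = solve-∀
  q∣ab : DividesCoeffs q (a *₁ b)
  q∣ab k = divides (prodℤ qs * h k)
    (trans (sym (qPh≈ab k)) (trans (const₁-*₁ (+ q * prodℤ qs) h k) (rearrange (+ q) (prodℤ qs) (h k))))
  cancel-q : ∀ {f} → (a *₁ b) ≈₁ (+ q ·₁ f) → (prodℤ qs ·₁ h) ≈₁ f
  cancel-q ab≈qf = ·₁-cancel (prime≢0 pq) (≈₁-trans (·₁-assoc (+ q) (prodℤ qs) h) (≈₁-trans qPh≈ab ab≈qf))
  split-off-q : DividesCoeffs q a ⊎ DividesCoeffs q b → Split h a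
  split-off-q (inj₁ q∣a) with DividesCoeffs⇒≈·₁ pq pa q∣a
  ... | a₁ , pa₁ , a≈qa₁ = record
    { primes = q ∷ R.primes ; primes-prime = pq ∷ R.primes-prime
    ; a′ = R.a′ ; b′ = R.b′ ; a′-poly = R.a′-poly ; b′-poly = R.b′-poly
    ; a≈ = ≈₁-trans a≈qa₁ (≈₁-trans (·₁-congˡ (+ q) R.a≈) (·₁-assoc (+ q) (prodℤ R.primes) R.a′))
    ; h≈ = R.h≈ }
    where
    module R = Split (prime-split qs pqs {h} pa₁ pb
                        (cancel-q (≈₁-trans (*₁-congʳ b a≈qa₁) (*₁-assoc (const₁ (+ q)) a₁ b))))
  split-off-q (inj₂ q∣b) with DividesCoeffs⇒≈·₁ pq pb q∣b
  ... | b₁ , pb₁ , b≈qb₁ =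
    prime-split qs pqs {h} pa pb₁ (cancel-q (≈₁-trans (*₁-congˡ a b≈qb₁) (·₁-*₁-commute (+ q) a b₁)))

scalar-split : ∀ {c h a b} → c ≢ 0ℤ → IsPoly₁ a → IsPoly₁ b → (c ·₁ h) ≈₁ (a *₁ b) → Split h a
scalar-split {c} {h} {a} {b} c≢0 pa pb ch≈ab with i≡±∏primes c c≢0
... | s , qs , ∣s∣≡1 , pqs , c≡sP = record
  { primes = R.primes ; primes-prime = R.primes-prime ; a′ = R.a′ ; a′-poly = R.a′-poly ; a≈ = R.a≈
  ; b′ = s ·₁ R.b′ ; b′-poly = IsPoly₁-·₁ s R.b′-poly
  ; h≈ = ≈₁-trans (≈₁-sym (·₁-unit-involutive h ∣s∣≡1))
           (≈₁-trans (·₁-congˡ s R.h≈) (≈₁-sym (·₁-*₁-commute s R.a′ R.b′))) }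
  where
  Psh≈ab : (prodℤ qs ·₁ (s ·₁ h)) ≈₁ (a *₁ b)
  Psh≈ab = ≈₁-trans (·₁-assoc (prodℤ qs) s h)
             (≈₁-trans (λ k → cong (λ z → (z ·₁ h) k) (trans (ℤP.*-comm (prodℤ qs) s) (sym c≡sP))) ch≈ab)
  module R = Split (prime-split qs pqs {s ·₁ h} pa pb Psh≈ab)

infix 4 _∣₁_

_∣₁_ : Coeffs₁ → Coeffs₁ → Set
p ∣₁ f = Σ Coeffs₁ λ w → IsPoly₁ w × (p *₁ w) ≈₁ f

Primitive : Coeffs₁ → Set
Primitive p = ∀ q → Prime q → ¬ DividesCoeffs q p

Primitive-∣·⇒∣ : ∀ {p w h c} → IsPoly₁ p → Primitive p → c ≢ 0ℤ → IsPoly₁ w →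
                 (p *₁ w) ≈₁ (c ·₁ h) → p ∣₁ h
Primitive-∣·⇒∣ {p} {w} {h} pp prim c≢0 pw pw≈ch with scalar-split {h = h} c≢0 pp pw (≈₁-sym pw≈ch)
... | record { primes = q ∷ qs ; primes-prime = pq ∷ _ ; a′ = a′ ; a≈ = p≈qa′ } =
  contradiction (λ k → subst (+ q ∣ℤ_) (sym (trans (p≈qa′ k) (const₁-*₁ _ a′ k)))
                           (ℤD.∣m⇒∣m*n (a′ k) (ℤD.∣m⇒∣m*n (prodℤ qs) ℤD.∣-refl)))
                (prim q pq)
... | record { primes = [] ; a′ = a′ ; b′ = b′ ; b′-poly = pb′ ; a≈ = p≈a′ ; h≈ = h≈a′b′ } =
  b′ , pb′ , ≈₁-sym (≈₁-trans h≈a′b′ (*₁-congʳ b′ (≈₁-sym (≈₁-trans p≈a′ (·₁-identityˡ a′)))))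

Irreducible-∣·⇒associated : ∀ {r w p c d} → Irreducible₁ p → IsPoly₁ r → HasDegree r d → 0 ℕ.< d →
  IsPoly₁ w → c ≢ 0ℤ → (r *₁ w) ≈₁ (c ·₁ p) → Σ ℤ λ c′ → c′ ≢ 0ℤ × r ≈₁ (c′ ·₁ p)
Irreducible-∣·⇒associated {r} {w} {p} {c} {d} (_ , _ , _ , irr) pr (rd≢0 , _) 0<d pw c≢0 rw≈cp
  = from-unit (irr S.a′ S.b′ S.a′-poly S.b′-poly S.h≈)
  where
  module S = Split (scalar-split {h = p} c≢0 pr pw (≈₁-sym rw≈cp))
  C = prodℤ S.primes
  from-unit : IsUnit₁ S.a′ ⊎ IsUnit₁ S.b′ → Σ ℤ λ c′ → c′ ≢ 0ℤ × r ≈₁ (c′ ·₁ p)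
  from-unit (inj₁ a′-unit) = contradiction (begin
    r d           ≡⟨ trans (S.a≈ d) (const₁-*₁ C S.a′ d) ⟩
    C * S.a′ d    ≡⟨ cong (C *_) (proj₂ (IsUnit₁-degree a′-unit) d 0<d) ⟩
    C * 0ℤ        ≡⟨ ℤP.*-zeroʳ C ⟩
    0ℤ            ∎) rd≢0
    where open ≡-Reasoning
  from-unit (inj₂ b′-unit) = C * t , Ct≢0 , r≈Ctp
    where
    t = S.b′ 0
    ∣t∣≡1 = IsUnit₁-∣const∣ b′-unit
    Ct≢0 : C * t ≢ 0ℤ
    Ct≢0 Ct≡0 with ℤP.i*j≡0⇒i≡0∨j≡0 C Ct≡0
    ... | inj₁ C≡0 = prodℤ≢0 S.primes-prime C≡0
    ... | inj₂ t≡0 = ∣i∣≡1⇒i≢0 ∣t∣≡1 t≡0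
    p≈ta′ : p ≈₁ (t ·₁ S.a′)
    p≈ta′ = ≈₁-trans S.h≈ (≈₁-trans (*₁-congˡ S.a′ (IsUnit₁⇒≈const b′-unit)) (*₁-comm S.a′ (const₁ t)))
    r≈Ctp : r ≈₁ ((C * t) ·₁ p)
    r≈Ctp = ≈₁-trans S.a≈ (≈₁-trans (·₁-congˡ C (≈₁-trans (≈₁-sym (·₁-unit-involutive S.a′ ∣t∣≡1))
                                                         (·₁-congˡ t (≈₁-sym p≈ta′))))
                                    (·₁-assoc C t p))

-- Pseudo-division

monomial : ℤ → ℕ → Coeffs₁
monomial c j k with k ℕP.≟ j
... | yes _ = c
... | no  _ = 0ℤ

monomial-*₁ : ∀ c j r k → j ℕ.≤ k → (monomial c j *₁ r) k ≡ c * r (k ∸ j)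
monomial-*₁ c j r k j≤k = trans (sumTo-single k j _ j≤k off) (cong (_* r (k ∸ j)) at)
  where
  off : ∀ a → a ℕ.≤ k → a ≢ j → monomial c j a * r (k ∸ a) ≡ 0ℤ
  off a _ a≢j with a ℕP.≟ j
  ... | yes a≡j = contradiction a≡j a≢j
  ... | no  _   = refl
  at : monomial c j j ≡ c
  at with j ℕP.≟ j
  ... | yes _   = refl
  ... | no  j≢j = contradiction refl j≢j

IsPoly₁-monomial : ∀ c j → IsPoly₁ (monomial c j)
IsPoly₁-monomial c j = suc j , above
  where
  above : ∀ k → suc j ℕ.≤ k → monomial c j k ≡ 0ℤ
  above k j<k with k ℕP.≟ j
  ... | yes refl = contradiction j<k (ℕP.<-irrefl refl)
  ... | no  _    = refl

record PseudoDivision (r a : Coeffs₁) (d : ℕ) : Set where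
  field
    m         : ℕ
    q s       : Coeffs₁
    q-poly    : IsPoly₁ q
    s-poly    : IsPoly₁ s
    s-bounded : Bounded₁ s d
    equation  : ((r d ^ m) ·₁ a) ≈₁ ((q *₁ r) +₁ s)

module _ {r d} (pr : IsPoly₁ r) (hr : HasDegree r d) where

  private
    ℓ = r d

  pseudo-divide-low : ∀ {D a} → D ℕ.≤ d → IsPoly₁ a → Bounded₁ a D → PseudoDivision r a d
  pseudo-divide-low {D} {a} D≤d pa a≤D = record
    { m = 0 ; q = zero₁ ; s = a ; q-poly = IsPoly₁-zero ; s-poly = pa
    ; s-bounded = λ k d≤k → a≤D k (ℕP.≤-trans D≤d d≤k)
    ; equation  = λ k → trans (·₁-identityˡ a k)
                              (sym (trans (cong (_+ a k) (sumTo-zero k _ (λ _ _ → refl))) (ℤP.+-identityˡ (a k)))) }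

  cancel-leading : ∀ {D a} → d ℕ.≤ D → Bounded₁ a (suc D) →
                   Bounded₁ ((ℓ ·₁ a) +₁ -₁ (monomial (a D) (D ∸ d) *₁ r)) D
  cancel-leading {D} {a} d≤D a≤D k D≤k with D ℕP.≟ k
  ... | yes refl = begin
    (ℓ ·₁ a) D + - (t *₁ r) D       ≡⟨ cong₂ (λ x y → x + - y) (const₁-*₁ ℓ a D) (monomial-*₁ (a D) j r D (ℕP.m∸n≤m D d)) ⟩
    ℓ * a D + - (a D * r (D ∸ j))   ≡⟨ cong (λ z → ℓ * a D + - (a D * r z)) (ℕP.m∸[m∸n]≡n d≤D) ⟩
    ℓ * a D + - (a D * ℓ)           ≡⟨ cong (λ z → ℓ * a D + - z) (ℤP.*-comm (a D) ℓ) ⟩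
    ℓ * a D + - (ℓ * a D)           ≡⟨ ℤP.+-inverseʳ (ℓ * a D) ⟩
    0ℤ                              ∎
    where
    open ≡-Reasoning
    j = D ∸ d
    t = monomial (a D) j
  ... | no D≢k = cong₂ (λ x y → x + - y)
    (trans (const₁-*₁ ℓ a k) (trans (cong (ℓ *_) (a≤D k D<k)) (ℤP.*-zeroʳ ℓ)))
    (trans (monomial-*₁ (a D) j r k (ℕP.≤-trans (ℕP.m∸n≤m D d) D≤k))
           (trans (cong (a D *_) (proj₂ hr (k ∸ j) d<k∸j)) (ℤP.*-zeroʳ (a D))))
    where
    j = D ∸ d
    D<k : D ℕ.< k
    D<k = ℕP.≤∧≢⇒< D≤k D≢k
    d<k∸j : d ℕ.< k ∸ j
    d<k∸j = ℕP.m+n≤o⇒m≤o∸n (suc d) (begin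
      suc d ℕ.+ j ≡⟨ cong suc (ℕP.m+[n∸m]≡n d≤D) ⟩
      suc D       ≤⟨ D<k ⟩
      k           ∎)
      where open ℕP.≤-Reasoning

  pseudo-divide : ∀ D a → IsPoly₁ a → Bounded₁ a D → PseudoDivision r a d
  pseudo-divide zero    a pa a≤0 = pseudo-divide-low z≤n pa a≤0
  pseudo-divide (suc D) a pa a≤D with suc D ℕP.≤? d
  ... | yes D<d = pseudo-divide-low D<d pa a≤D
  ... | no  D≮d = record
    { m = suc R.m ; q = R.q +₁ (X *₁ t) ; s = R.s
    ; q-poly = IsPoly₁-+ R.q-poly (IsPoly₁-·₁ (ℓ ^ R.m) (IsPoly₁-monomial (a D) (D ∸ d)))
    ; s-poly = R.s-poly ; s-bounded = R.s-bounded ; equation = equation }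
    where
    t = monomial (a D) (D ∸ d)
    a′ = (ℓ ·₁ a) +₁ -₁ (t *₁ r)
    a′-poly : IsPoly₁ a′
    a′-poly = IsPoly₁-+ (IsPoly₁-·₁ ℓ pa) (IsPoly₁-neg (IsPoly₁-* (IsPoly₁-monomial (a D) (D ∸ d)) pr))
    module R = PseudoDivision (pseudo-divide D a′ a′-poly (cancel-leading (ℕP.≤-pred (ℕP.≰⇒> D≮d)) a≤D))
    X = const₁ (ℓ ^ R.m)
    equation : ((ℓ ^ suc R.m) ·₁ a) ≈₁ (((R.q +₁ (X *₁ t)) *₁ r) +₁ R.s)
    equation = begin
      ((ℓ ^ suc R.m) ·₁ a)                   ≈⟨ (λ k → cong (λ z → (z ·₁ a) k) (ℤP.*-comm ℓ (ℓ ^ R.m))) ⟩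
      ((ℓ ^ R.m * ℓ) ·₁ a)                   ≈⟨ ≈₁-sym (·₁-assoc (ℓ ^ R.m) ℓ a) ⟩
      X *₁ (ℓ ·₁ a)                          ≈⟨ solve 4 (λ X La t r → X :* La := X :* (La :+ :- (t :* r)) :+ X :* t :* r)
                                                        ≈₁-refl X (ℓ ·₁ a) t r ⟩
      (X *₁ a′) +₁ ((X *₁ t) *₁ r)           ≈⟨ (λ k → cong (_+ ((X *₁ t) *₁ r) k) (R.equation k)) ⟩
      ((R.q *₁ r) +₁ R.s) +₁ ((X *₁ t) *₁ r) ≈⟨ solve 5 (λ q r s X t → q :* r :+ s :+ X :* t :* r := (q :+ X :* t) :* r :+ s)
                                                        ≈₁-refl R.q r R.s X t ⟩
      ((R.q +₁ (X *₁ t)) *₁ r) +₁ R.s        ∎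
      where open ≈₁-Reasoning

-- Irreducible polynomials in ℤ[x] are prime

∣₁-zero : ∀ {p f} → f ≈₁ zero₁ → p ∣₁ f
∣₁-zero {p} f≈0 = zero₁ , IsPoly₁-zero , λ k → trans (sumTo-zero k _ (λ a _ → ℤP.*-zeroʳ (p a))) (sym (f≈0 k))

-- Descent on the degree of r in the ideal (p , f): pseudo-dividing p and f by r leaves remainders
-- in the ideal of smaller degree. If both vanish, r is a scalar multiple of p because p is
-- irreducible, so p divides a scalar multiple of f, hence f because p is primitive.
module IdealOf {p f : Coeffs₁} (pp : IsPoly₁ p) (irr : Irreducible₁ p) (prim : Primitive p) (pf : IsPoly₁ f) where

  InIdeal : Coeffs₁ → Set
  InIdeal r = Σ Coeffs₁ λ u → Σ Coeffs₁ λ v → IsPoly₁ u × IsPoly₁ v × r ≈₁ ((u *₁ p) +₁ (v *₁ f))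

  Outcome : Set
  Outcome = p ∣₁ f ⊎ Σ Coeffs₁ λ u → Σ Coeffs₁ λ v → Σ ℤ λ c →
            IsPoly₁ u × IsPoly₁ v × c ≢ 0ℤ × ((u *₁ p) +₁ (v *₁ f)) ≈₁ const₁ c

  p∈ : InIdeal p
  p∈ = const₁ 1ℤ , const₁ 0ℤ , IsPoly₁-const 1ℤ , IsPoly₁-const 0ℤ ,
       solve 2 (λ p f → p := con 1ℤ :* p :+ con 0ℤ :* f) ≈₁-refl p f

  f∈ : InIdeal f
  f∈ = const₁ 0ℤ , const₁ 1ℤ , IsPoly₁-const 0ℤ , IsPoly₁-const 1ℤ ,
       solve 2 (λ p f → f := con 0ℤ :* p :+ con 1ℤ :* f) ≈₁-refl p f

  InIdeal-remainder : ∀ {X q a b s} → IsPoly₁ X → IsPoly₁ q → InIdeal a → InIdeal b →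
                      (X *₁ a) ≈₁ ((q *₁ b) +₁ s) → InIdeal s
  InIdeal-remainder {X} {q} {a} {b} {s} pX pq (u₁ , v₁ , pu₁ , pv₁ , a≈) (u₂ , v₂ , pu₂ , pv₂ , b≈) Xa≈qb+s =
    (X *₁ u₁ +₁ -₁ (q *₁ u₂)) , (X *₁ v₁ +₁ -₁ (q *₁ v₂)) ,
    IsPoly₁-+ (IsPoly₁-* pX pu₁) (IsPoly₁-neg (IsPoly₁-* pq pu₂)) ,
    IsPoly₁-+ (IsPoly₁-* pX pv₁) (IsPoly₁-neg (IsPoly₁-* pq pv₂)) ,
    (begin
      s                                              ≈⟨ solve 3 (λ s Xa qb → s := qb :+ s :+ :- qb) ≈₁-refl s (X *₁ a) (q *₁ b) ⟩
      (q *₁ b +₁ s) +₁ -₁ (q *₁ b)                   ≈⟨ (λ k → cong (_+ - (q *₁ b) k) (sym (Xa≈qb+s k))) ⟩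
      X *₁ a +₁ -₁ (q *₁ b)                          ≈⟨ (λ k → cong₂ (λ x y → x + - y) (*₁-congˡ X a≈ k) (*₁-congˡ q b≈ k)) ⟩
      X *₁ (u₁ *₁ p +₁ v₁ *₁ f) +₁ -₁ (q *₁ (u₂ *₁ p +₁ v₂ *₁ f))
        ≈⟨ solve 8 (λ X q u₁ v₁ u₂ v₂ p f →
               X :* (u₁ :* p :+ v₁ :* f) :+ :- (q :* (u₂ :* p :+ v₂ :* f))
            := (X :* u₁ :+ :- (q :* u₂)) :* p :+ (X :* v₁ :+ :- (q :* v₂)) :* f) ≈₁-refl X q u₁ v₁ u₂ v₂ p f ⟩
      (X *₁ u₁ +₁ -₁ (q *₁ u₂)) *₁ p +₁ (X *₁ v₁ +₁ -₁ (q *₁ v₂)) *₁ f ∎)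
    where open ≈₁-Reasoning

  private
    ^≢0 : ∀ {ℓ} m → ℓ ≢ 0ℤ → ℓ ^ m ≢ 0ℤ
    ^≢0 {ℓ} m ℓ≢0 ℓ^m≡0 = ℓ≢0 (ℤP.i^n≡0⇒i≡0 ℓ m ℓ^m≡0)

    exact : ∀ {g h s} → g ≈₁ (h +₁ s) → s ≈₁ zero₁ → g ≈₁ h
    exact {h = h} g≈h+s s≈0 k = trans (g≈h+s k) (trans (cong (_+_ (h k)) (s≈0 k)) (ℤP.+-identityʳ (h k)))

  OutcomeAt : ℕ → Set
  OutcomeAt d = ∀ r → IsPoly₁ r → HasDegree r d → InIdeal r → Outcome

  zero⊎smaller : ∀ {d s} → (∀ {e} → e ℕ.< d → OutcomeAt e) → IsPoly₁ s → Bounded₁ s d → InIdeal s →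
                 (s ≈₁ zero₁ → Outcome) → Outcome
  zero⊎smaller ih ps s≤d s∈ if-zero with zero-or-degree ps
  ... | inj₁ s≈0      = if-zero s≈0
  ... | inj₂ (e , he) = ih (Bounded₁⇒degree< s≤d he) _ ps he s∈

  outcome : ∀ d → OutcomeAt d
  outcome = <-rec OutcomeAt step
    where
    step : ∀ d → (∀ {e} → e ℕ.< d → OutcomeAt e) → OutcomeAt d
    step zero    _  r _  hr (u , v , pu , pv , r≈) =
      inj₂ (u , v , r 0 , pu , pv , proj₁ hr , ≈₁-trans (≈₁-sym r≈) (HasDegree0⇒≈const hr))
    step (suc d) ih r pr hr r∈ = zero⊎smaller ih P.s-poly P.s-bounded P.s∈ r∣p
      where
      module Remainder {a} (pa : IsPoly₁ a) (a∈ : InIdeal a) where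
        open PseudoDivision (pseudo-divide pr hr (proj₁ pa) a pa (proj₂ pa)) public
        s∈ : InIdeal s
        s∈ = InIdeal-remainder (IsPoly₁-const _) q-poly a∈ r∈ equation
        ℓ^m≢0 : r (suc d) ^ m ≢ 0ℤ
        ℓ^m≢0 = ^≢0 m (proj₁ hr)
      module P = Remainder pp p∈
      module F = Remainder pf f∈
      r∣p : P.s ≈₁ zero₁ → Outcome
      r∣p s≈0 = associated (Irreducible-∣·⇒associated irr pr hr (s≤s z≤n) P.q-poly P.ℓ^m≢0 rq≈ℓ^mp)
        where
        rq≈ℓ^mp : (r *₁ P.q) ≈₁ ((r (suc d) ^ P.m) ·₁ p)
        rq≈ℓ^mp = ≈₁-trans (*₁-comm r P.q) (≈₁-sym (exact {h = P.q *₁ r} {s = P.s} P.equation s≈0))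
        associated : (Σ ℤ λ c′ → c′ ≢ 0ℤ × r ≈₁ (c′ ·₁ p)) → Outcome
        associated (c′ , _ , r≈c′p) = zero⊎smaller ih F.s-poly F.s-bounded F.s∈ p∣f
          where
          p∣f : F.s ≈₁ zero₁ → Outcome
          p∣f s≈0 = inj₁ (Primitive-∣·⇒∣ pp prim F.ℓ^m≢0 (IsPoly₁-·₁ c′ F.q-poly) (begin
            p *₁ (c′ ·₁ F.q)       ≈⟨ solve 3 (λ C p q → p :* (C :* q) := q :* (C :* p)) ≈₁-refl (const₁ c′) p F.q ⟩
            F.q *₁ (c′ ·₁ p)       ≈⟨ *₁-congˡ F.q (≈₁-sym r≈c′p) ⟩
            F.q *₁ r               ≈⟨ ≈₁-sym (exact {h = F.q *₁ r} {s = F.s} F.equation s≈0) ⟩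
            (r (suc d) ^ F.m) ·₁ f ∎))
            where open ≈₁-Reasoning

Irreducible⇒Primitive : ∀ {p d} → Irreducible₁ p → HasDegree p (suc d) → Primitive p
Irreducible⇒Primitive {p} {d} (pp , _ , _ , irr) (p[1+d]≢0 , _) q pq q∣p = unit-factor (irr _ _ (IsPoly₁-const (+ q)) pp′ p≈qp′)
  where
  F = DividesCoeffs⇒≈·₁ pq pp q∣p
  p′ = proj₁ F
  pp′ = proj₁ (proj₂ F)
  p≈qp′ = proj₂ (proj₂ F)
  unit-factor : IsUnit₁ (const₁ (+ q)) ⊎ IsUnit₁ p′ → ⊥
  unit-factor (inj₁ q-unit)  = nonTrivial⇒≢1 {{prime⇒nonTrivial pq}} (IsUnit₁-∣const∣ q-unit)
  unit-factor (inj₂ p′-unit) = p[1+d]≢0 (begin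
    p (suc d)           ≡⟨ trans (p≈qp′ (suc d)) (const₁-*₁ (+ q) p′ (suc d)) ⟩
    + q * p′ (suc d)    ≡⟨ cong (+ q *_) (proj₂ (IsUnit₁-degree p′-unit) (suc d) (s≤s z≤n)) ⟩
    + q * 0ℤ            ≡⟨ ℤP.*-zeroʳ (+ q) ⟩
    0ℤ                  ∎)
    where open ≡-Reasoning

-- If u p + v f = c then p (u g + v w) = c g, and Gauss's lemma lets us drop c.
positive-degree-Irreducible⇒prime : ∀ {p f g d} → Irreducible₁ p → HasDegree p (suc d) → IsPoly₁ f → IsPoly₁ g →
                                    p ∣₁ (f *₁ g) → p ∣₁ f ⊎ p ∣₁ g
positive-degree-Irreducible⇒prime {p} {f} {g} irr hp pf pg (w , pw , pw≈fg) = by-degree (zero-or-degree pf)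
  where
  pp = proj₁ irr
  prim = Irreducible⇒Primitive irr hp
  open IdealOf pp irr prim pf using (Outcome; outcome; f∈)
  from-outcome : Outcome → p ∣₁ f ⊎ p ∣₁ g
  from-outcome (inj₁ p∣f) = inj₁ p∣f
  from-outcome (inj₂ (u , v , c , pu , pv , c≢0 , up+vf≈c)) =
    inj₂ (Primitive-∣·⇒∣ pp prim c≢0 (IsPoly₁-+ (IsPoly₁-* pu pg) (IsPoly₁-* pv pw)) (begin
      p *₁ (u *₁ g +₁ v *₁ w)          ≈⟨ solve 5 (λ p u g v w → p :* (u :* g :+ v :* w) := u :* p :* g :+ v :* (p :* w)) ≈₁-refl p u g v w ⟩
      (u *₁ p) *₁ g +₁ v *₁ (p *₁ w)   ≈⟨ (λ k → cong (_+_ (((u *₁ p) *₁ g) k)) (*₁-congˡ v pw≈fg k)) ⟩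
      (u *₁ p) *₁ g +₁ v *₁ (f *₁ g)   ≈⟨ solve 5 (λ p u g v f → u :* p :* g :+ v :* (f :* g) := (u :* p :+ v :* f) :* g) ≈₁-refl p u g v f ⟩
      (u *₁ p +₁ v *₁ f) *₁ g          ≈⟨ *₁-congʳ g up+vf≈c ⟩
      c ·₁ g                           ∎))
    where open ≈₁-Reasoning
  by-degree : f ≈₁ zero₁ ⊎ ∃ (HasDegree f) → p ∣₁ f ⊎ p ∣₁ g
  by-degree (inj₁ f≈0)      = inj₁ (∣₁-zero {p} f≈0)
  by-degree (inj₂ (e , he)) = from-outcome (outcome e f pf he f∈)

constant-Irreducible⇒prime-abs : ∀ {p c} → Irreducible₁ p → p ≈₁ const₁ c → Prime ∣ c ∣
constant-Irreducible⇒prime-abs {p} {c} (_ , p≉0 , p-nonunit , irr) p≈c =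
  irreducible⇒prime {{nonTrivial ∣ c ∣ (c≢0 ∘ ℤP.∣i∣≡0⇒i≡0) ∣c∣≢1}} ∣c∣-irreducible
  where
  c≢0 : c ≢ 0ℤ
  c≢0 c≡0 = p≉0 (λ { zero → trans (p≈c zero) c≡0 ; (suc k) → p≈c (suc k) })
  ∣c∣≢1 : ∣ c ∣ ≢ 1
  ∣c∣≢1 ∣c∣≡1 = p-nonunit (IsUnit₁-resp-≈ (≈₁-sym p≈c) (const₁-IsUnit₁ ∣c∣≡1))
  nonTrivial : ∀ n → n ≢ 0 → n ≢ 1 → NonTrivial n
  nonTrivial zero          n≢0 _   = contradiction refl n≢0
  nonTrivial (suc zero)    _   n≢1 = contradiction refl n≢1
  nonTrivial (suc (suc n)) _   _   = _
  s = proj₁ (i≡±∣i∣ c)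
  ∣c∣-irreducible : Irreducible ∣ c ∣
  ∣c∣-irreducible {d} (ℕD.divides e ∣c∣≡ed) = Sum.map IsUnit₁-∣const∣ e-unit⇒d≡∣c∣
    (irr (const₁ (+ d)) (const₁ (s * + e)) (IsPoly₁-const _) (IsPoly₁-const _) p≈de)
    where
    rearrange : ∀ s e d → s * (e * d) ≡ d * (s * e)
    rearrange = solve-∀
    c≡de : c ≡ + d * (s * + e)
    c≡de = trans (proj₂ (proj₂ (i≡±∣i∣ c))) (trans (cong (λ z → s * + z) ∣c∣≡ed)
                 (trans (cong (s *_) (ℤP.pos-* e d)) (rearrange s (+ e) (+ d))))
    p≈de : p ≈₁ (const₁ (+ d) *₁ const₁ (s * + e))
    p≈de = ≈₁-trans p≈c (≈₁-trans (λ k → cong (λ z → const₁ z k) c≡de) (≈₁-sym (const₁-*₁-const₁ (+ d) (s * + e))))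
    e-unit⇒d≡∣c∣ : IsUnit₁ (const₁ (s * + e)) → d ≡ ∣ c ∣
    e-unit⇒d≡∣c∣ se-unit = sym (trans ∣c∣≡ed (trans (cong (ℕ._* d) e≡1) (ℕP.*-identityˡ d)))
      where
      e≡1 : e ≡ 1
      e≡1 = ℕP.m*n≡1⇒n≡1 ∣ s ∣ e (trans (sym (ℤP.abs-* s (+ e))) (IsUnit₁-∣const∣ se-unit))

-- A constant irreducible is ± a rational prime q, and by Gauss's lemma q is prime in ℤ[x].
constant-Irreducible⇒prime : ∀ {p c f g} → Irreducible₁ p → p ≈₁ const₁ c → IsPoly₁ f → IsPoly₁ g →
                             p ∣₁ (f *₁ g) → p ∣₁ f ⊎ p ∣₁ g
constant-Irreducible⇒prime {p} {c} {f} {g} irr p≈c pf pg (w , pw , pw≈fg) =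
  Sum.map (∣c∣∣⇒p∣ pf) (∣c∣∣⇒p∣ pg) (gauss-lemma ∣c∣-prime pf pg ∣c∣∣fg)
  where
  ∣c∣-prime = constant-Irreducible⇒prime-abs irr p≈c
  s = proj₁ (i≡±∣i∣ c)
  c*s≡∣c∣ : c * s ≡ + ∣ c ∣
  c*s≡∣c∣ = trans (cong (_* s) (proj₂ (proj₂ (i≡±∣i∣ c))))
              (trans (rearrange s (+ ∣ c ∣)) (trans (cong (_* + ∣ c ∣) (∣i∣≡1⇒i*i≡1 s (proj₁ (proj₂ (i≡±∣i∣ c)))))
                                                    (ℤP.*-identityˡ _)))
    where
    rearrange : ∀ s n → s * n * s ≡ s * s * n
    rearrange = solve-∀
  ∣c∣∣fg : DividesCoeffs ∣ c ∣ (f *₁ g)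
  ∣c∣∣fg k = subst (+ ∣ c ∣ ∣ℤ_) (trans (sym (const₁-*₁ c w k)) (trans (*₁-congʳ w (≈₁-sym p≈c) k) (pw≈fg k)))
                  (ℤD.∣m⇒∣m*n (w k) (ℤD.∣m∣∣m {c}))
  ∣c∣∣⇒p∣ : ∀ {h} → IsPoly₁ h → DividesCoeffs ∣ c ∣ h → p ∣₁ h
  ∣c∣∣⇒p∣ {h} ph ∣c∣∣h with DividesCoeffs⇒≈·₁ ∣c∣-prime ph ∣c∣∣h
  ... | h′ , ph′ , h≈∣c∣h′ = s ·₁ h′ , IsPoly₁-·₁ s ph′ , (begin
    p *₁ (s ·₁ h′)          ≈⟨ *₁-congʳ (s ·₁ h′) p≈c ⟩
    c ·₁ (s ·₁ h′)          ≈⟨ ·₁-assoc c s h′ ⟩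
    (c * s) ·₁ h′           ≈⟨ (λ k → cong (λ z → (z ·₁ h′) k) c*s≡∣c∣) ⟩
    + ∣ c ∣ ·₁ h′           ≈⟨ ≈₁-sym h≈∣c∣h′ ⟩
    h                       ∎)
    where open ≈₁-Reasoning

Irreducible⇒prime : ∀ {p f g} → Irreducible₁ p → IsPoly₁ f → IsPoly₁ g → p ∣₁ (f *₁ g) → p ∣₁ f ⊎ p ∣₁ g
Irreducible⇒prime irr with ≉0⇒degree (proj₁ irr) (proj₁ (proj₂ irr))
... | zero  , hp = constant-Irreducible⇒prime irr (HasDegree0⇒≈const hp)
... | suc d , hp = positive-degree-Irreducible⇒prime irr hp

-- Counting irreducible factors

NonUnit₁ : Coeffs₁ → Set
NonUnit₁ m = IsPoly₁ m × ¬ IsUnit₁ m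

IsPoly₁-prod : ∀ {L} → All IsPoly₁ L → IsPoly₁ (prod₁ L)
IsPoly₁-prod []         = IsPoly₁-one
IsPoly₁-prod (pp ∷ pps) = IsPoly₁-* pp (IsPoly₁-prod pps)

record Extraction (p : Coeffs₁) (M : List Coeffs₁) : Set where
  field
    m            : Coeffs₁
    rest         : List Coeffs₁
    rest-nonunit : All NonUnit₁ rest
    prod≈        : prod₁ M ≈₁ (m *₁ prod₁ rest)
    length≡      : length M ≡ suc (length rest)
    p∣m          : p ∣₁ m

extract : ∀ {p} → Irreducible₁ p → ∀ M → All NonUnit₁ M → p ∣₁ prod₁ M → Extraction p M
extract irr []      []         p∣1 = contradiction (proj₁ irr , p∣1) (proj₁ (proj₂ (proj₂ irr)))
extract {p} irr (m ∷ M) (nm ∷ nM) p∣mM =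
  [ at-head , in-tail ] (Irreducible⇒prime irr (proj₁ nm) (IsPoly₁-prod (All.map proj₁ nM)) p∣mM)
  where
  at-head : p ∣₁ m → Extraction p (m ∷ M)
  at-head p∣m = record { m = m ; rest = M ; rest-nonunit = nM ; prod≈ = ≈₁-refl ; length≡ = refl ; p∣m = p∣m }
  in-tail : p ∣₁ prod₁ M → Extraction p (m ∷ M)
  in-tail p∣M = record
    { m = E.m ; rest = m ∷ E.rest ; rest-nonunit = nm ∷ E.rest-nonunit
    ; prod≈ = ≈₁-trans (*₁-congˡ m E.prod≈)
                (solve 3 (λ a b c → a :* (b :* c) := b :* (a :* c)) ≈₁-refl m E.m (prod₁ E.rest))
    ; length≡ = cong suc E.length≡ ; p∣m = E.p∣m }
    where module E = Extraction (extract irr M nM p∣M)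

IsUnit₁-*₁⇒IsUnit₁ʳ : ∀ {e m} → IsPoly₁ e → IsPoly₁ m → IsUnit₁ (e *₁ m) → IsUnit₁ m
IsUnit₁-*₁⇒IsUnit₁ʳ {e} {m} pe pm (_ , v , pv , em*v≈1) =
  pm , e *₁ v , IsPoly₁-* pe pv ,
  ≈₁-trans (solve 3 (λ m e v → m :* (e :* v) := (e :* m) :* v) ≈₁-refl m e v) em*v≈1

-- p e = m for some m ∈ M; absorbing the cofactor e into another member of M keeps them non-units.
length-nonunits≤length-irreducibles : ∀ L → All Irreducible₁ L → ∀ M → All NonUnit₁ M →
                                      prod₁ M ≈₁ prod₁ L → length M ≤ length L
length-nonunits≤length-irreducibles [] [] []      []        _    = z≤n
length-nonunits≤length-irreducibles [] [] (m ∷ M) (nm ∷ nM) mM≈1 =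
  contradiction (proj₁ nm , prod₁ M , IsPoly₁-prod (All.map proj₁ nM) , mM≈1) (proj₂ nm)
length-nonunits≤length-irreducibles (p ∷ L) (irr ∷ irrs) M nM M≈pL =
  subst (_≤ suc (length L)) (sym E.length≡) (s≤s (absorb E.rest E.rest-nonunit e-rest≈L))
  where
  pL = IsPoly₁-prod (All.map proj₁ irrs)
  module E = Extraction (extract irr M nM (prod₁ L , pL , ≈₁-sym M≈pL))
  e  = proj₁ E.p∣m
  pe = proj₁ (proj₂ E.p∣m)
  e-rest≈L : (e *₁ prod₁ E.rest) ≈₁ prod₁ L
  e-rest≈L = *₁-cancelˡ (proj₁ irr) (proj₁ (proj₂ irr)) (IsPoly₁-* pe (IsPoly₁-prod (All.map proj₁ E.rest-nonunit))) pL
    (≈₁-trans (≈₁-sym (*₁-assoc p e (prod₁ E.rest)))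
      (≈₁-trans (*₁-congʳ (prod₁ E.rest) (proj₂ (proj₂ E.p∣m))) (≈₁-trans (≈₁-sym E.prod≈) M≈pL)))
  absorb : ∀ R → All NonUnit₁ R → (e *₁ prod₁ R) ≈₁ prod₁ L → length R ≤ length L
  absorb []      _                         _      = z≤n
  absorb (m ∷ R) ((pm , m-nonunit) ∷ nR) e-mR≈L =
    length-nonunits≤length-irreducibles L irrs ((e *₁ m) ∷ R)
      ((IsPoly₁-* pe pm , m-nonunit ∘ IsUnit₁-*₁⇒IsUnit₁ʳ pe pm) ∷ nR)
      (≈₁-trans (*₁-assoc e m (prod₁ R)) e-mR≈L)

-- Specialising y to x

≈₂-sym : ∀ {f g} → f ≈₂ g → g ≈₂ f
≈₂-sym f≈g i j = sym (f≈g i j)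

-- Both sides equal  Σ_{a + b + t + u = k} f a b · g t u,  summed over a, then b, then t.
private
  diag-*₂-normal : Coeffs₂ → Coeffs₂ → ℕ → ℤ
  diag-*₂-normal f g k =
    sumTo k (λ a → sumTo (k ∸ a) (λ b → sumTo (k ∸ a ∸ b) (λ t → f a b * g t (k ∸ a ∸ b ∸ t))))

  diag-*₂≡normal : ∀ f g k → diag (f *₂ g) k ≡ diag-*₂-normal f g k
  diag-*₂≡normal f g k = begin
    sumTo k (λ i → sumTo i (λ a → sumTo (k ∸ i) (λ b → f a b * g (i ∸ a) (k ∸ i ∸ b))))
      ≡⟨ sumTo-triangle k (λ i a → sumTo (k ∸ i) (λ b → f a b * g (i ∸ a) (k ∸ i ∸ b))) ⟩
    sumTo k (λ a → sumTo (k ∸ a) (λ t → sumTo (k ∸ (a ℕ.+ t)) (λ b → f a b * g (a ℕ.+ t ∸ a) (k ∸ (a ℕ.+ t) ∸ b))))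
      ≡⟨ sumTo-cong k (λ a → sumTo-cong (k ∸ a) (λ t → cong₂ (λ m n → sumTo m (λ b → f a b * g n (m ∸ b)))
                                                               (sym (ℕP.∸-+-assoc k a t)) (ℕP.m+n∸m≡n a t))) ⟩
    sumTo k (λ a → sumTo (k ∸ a) (λ t → sumTo (k ∸ a ∸ t) (λ b → f a b * g t (k ∸ a ∸ t ∸ b))))
      ≡⟨ sumTo-cong k (λ a → sumTo-swap (k ∸ a) (λ t b → f a b * g t (k ∸ a ∸ t ∸ b))) ⟩
    sumTo k (λ a → sumTo (k ∸ a) (λ b → sumTo (k ∸ a ∸ b) (λ t → f a b * g t (k ∸ a ∸ t ∸ b))))
      ≡⟨ sumTo-cong k (λ a → sumTo-cong (k ∸ a) (λ b → sumTo-cong (k ∸ a ∸ b) (λ t →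
           cong (λ z → f a b * g t z) (∸-swap (k ∸ a) t b)))) ⟩
    diag-*₂-normal f g k ∎
    where
    open ≡-Reasoning
    ∸-swap : ∀ K t b → K ∸ t ∸ b ≡ K ∸ b ∸ t
    ∸-swap K t b = trans (ℕP.∸-+-assoc K t b) (trans (cong (K ∸_) (ℕP.+-comm t b)) (sym (ℕP.∸-+-assoc K b t)))

  diag-*₁-diag≡normal : ∀ f g k → (diag f *₁ diag g) k ≡ diag-*₂-normal f g k
  diag-*₁-diag≡normal f g k = begin
    sumTo k (λ m → sumTo m (λ a → f a (m ∸ a)) * sumTo (k ∸ m) (λ t → g t (k ∸ m ∸ t)))
      ≡⟨ sumTo-cong k (λ m → *-distribʳ-sumTo m _ (λ a → f a (m ∸ a))) ⟩
    sumTo k (λ m → sumTo m (λ a → f a (m ∸ a) * diag g (k ∸ m)))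
      ≡⟨ sumTo-triangle k (λ m a → f a (m ∸ a) * diag g (k ∸ m)) ⟩
    sumTo k (λ a → sumTo (k ∸ a) (λ b → f a (a ℕ.+ b ∸ a) * diag g (k ∸ (a ℕ.+ b))))
      ≡⟨ sumTo-cong k (λ a → sumTo-cong (k ∸ a) (λ b → cong₂ (λ z w → f a z * diag g w)
                                                              (ℕP.m+n∸m≡n a b) (sym (ℕP.∸-+-assoc k a b)))) ⟩
    sumTo k (λ a → sumTo (k ∸ a) (λ b → f a b * diag g (k ∸ a ∸ b)))
      ≡⟨ sumTo-cong k (λ a → sumTo-cong (k ∸ a) (λ b → *-distribˡ-sumTo (k ∸ a ∸ b) (f a b) _)) ⟩
    diag-*₂-normal f g k ∎
    where open ≡-Reasoning

diag-*₂ : ∀ f g → diag (f *₂ g) ≈₁ (diag f *₁ diag g)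
diag-*₂ f g k = trans (diag-*₂≡normal f g k) (sym (diag-*₁-diag≡normal f g k))

diag-one₂ : diag one₂ ≈₁ one₁
diag-one₂ zero    = refl
diag-one₂ (suc k) = sumTo-zero (suc k) _ (λ { zero _ → refl ; (suc i) _ → refl })

diag-cong : ∀ {f g} → f ≈₂ g → diag f ≈₁ diag g
diag-cong f≈g k = sumTo-cong k (λ i → f≈g i (k ∸ i))

IsPoly₁-diag : ∀ {f} → IsPoly₂ f → IsPoly₁ (diag f)
IsPoly₁-diag (N , f≡0) = N , λ k N≤k → sumTo-zero k _ (λ i i≤k →
  f≡0 i (k ∸ i) (ℕP.≤-trans N≤k (ℕP.≤-reflexive (sym (ℕP.m+[n∸m]≡n i≤k)))))

IsUnit₂⇒IsUnit₁-diag : ∀ {Q} → IsUnit₂ Q → IsUnit₁ (diag Q)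
IsUnit₂⇒IsUnit₁-diag {Q} (pQ , V , pV , QV≈1) =
  IsPoly₁-diag pQ , diag V , IsPoly₁-diag pV , ≈₁-trans (≈₁-sym (diag-*₂ Q V)) (≈₁-trans (diag-cong QV≈1) diag-one₂)

TotalBounded : Coeffs₂ → ℕ → Set
TotalBounded Q d = ∀ i j → d ℕ.< i ℕ.+ j → Q i j ≡ 0ℤ

-- The homogeneous component of Q of degree d, as a polynomial in x (with y = 1); for i > d it
-- reads Q i 0, which vanishes as soon as Q is TotalBounded by d.
top : ℕ → Coeffs₂ → Coeffs₁
top d Q i = Q i (d ∸ i)

HasTotalDegree : Coeffs₂ → ℕ → Set
HasTotalDegree Q d = TotalBounded Q d × ¬ top d Q ≈₁ zero₁

IsPoly₁-top : ∀ {Q d} → TotalBounded Q d → Bounded₁ (top d Q) (suc d)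
IsPoly₁-top {d = d} Q≤d i d<i = Q≤d i (d ∸ i) (ℕP.<-≤-trans d<i (ℕP.m≤m+n i (d ∸ i)))

TotalBounded⇒top≈0 : ∀ {Q d e} → TotalBounded Q d → d ℕ.< e → top e Q ≈₁ zero₁
TotalBounded⇒top≈0 {e = e} Q≤d d<e i = Q≤d i (e ∸ i) (ℕP.<-≤-trans d<e (ℕP.m≤n+m∸n e i))

HasTotalDegree-unique : ∀ {Q d e} → HasTotalDegree Q d → HasTotalDegree Q e → d ≡ e
HasTotalDegree-unique {d = d} {e} (Q≤d , top-d≉0) (Q≤e , top-e≉0) with ℕP.<-cmp d e
... | tri< d<e _ _ = contradiction (TotalBounded⇒top≈0 Q≤d d<e) top-e≉0
... | tri≈ _ d≡e _ = d≡e
... | tri> _ _ e<d = contradiction (TotalBounded⇒top≈0 Q≤e e<d) top-d≉0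

HasTotalDegree-resp-≈ : ∀ {Q Q′ d} → Q ≈₂ Q′ → HasTotalDegree Q d → HasTotalDegree Q′ d
HasTotalDegree-resp-≈ Q≈Q′ (Q≤d , top≉0) =
  (λ i j lt → trans (sym (Q≈Q′ i j)) (Q≤d i j lt)) , λ top′≈0 → top≉0 (λ i → trans (Q≈Q′ i _) (top′≈0 i))

TotalBounded-lower : ∀ {Q d} → TotalBounded Q (suc d) → top (suc d) Q ≈₁ zero₁ → TotalBounded Q d
TotalBounded-lower {Q} {d} Q≤1+d top≈0 i j d<i+j with suc d ℕP.≟ i ℕ.+ j
... | yes 1+d≡i+j = subst (λ z → Q i z ≡ 0ℤ) (trans (cong (_∸ i) 1+d≡i+j) (ℕP.m+n∸m≡n i j)) (top≈0 i)
... | no  1+d≢i+j = Q≤1+d i j (ℕP.≤∧≢⇒< d<i+j 1+d≢i+j)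

zero⊎total-degree : ∀ {Q} d → TotalBounded Q d → Q ≈₂ zero₂ ⊎ ∃ (HasTotalDegree Q)
zero⊎total-degree {Q} d Q≤d with zero-or-degree {top d Q} (suc d , IsPoly₁-top Q≤d)
... | inj₂ (_ , hd) = inj₂ (d , Q≤d , HasDegree⇒≉0 hd)
... | inj₁ top≈0    = lower d Q≤d top≈0
  where
  lower : ∀ d → TotalBounded Q d → top d Q ≈₁ zero₁ → Q ≈₂ zero₂ ⊎ ∃ (HasTotalDegree Q)
  lower zero     Q≤0 top≈0 = inj₁ λ { zero zero → top≈0 0 ; zero (suc j) → Q≤0 0 (suc j) (s≤s z≤n)
                                    ; (suc i) j → Q≤0 (suc i) j (s≤s z≤n) }
  lower (suc d′) Q≤d top≈0 = zero⊎total-degree d′ (TotalBounded-lower Q≤d top≈0)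

≉0⇒total-degree : ∀ {Q} → IsPoly₂ Q → ¬ Q ≈₂ zero₂ → ∃ (HasTotalDegree Q)
≉0⇒total-degree (N , Q≡0) Q≉0 with zero⊎total-degree N (λ i j N<i+j → Q≡0 i j (ℕP.<⇒≤ N<i+j))
... | inj₁ Q≈0 = contradiction Q≈0 Q≉0
... | inj₂ hd  = hd

TotalBounded⇒diag-Bounded₁ : ∀ {Q d} → TotalBounded Q d → Bounded₁ (diag Q) (suc d)
TotalBounded⇒diag-Bounded₁ Q≤d k d<k =
  sumTo-zero k _ (λ i i≤k → Q≤d i (k ∸ i) (ℕP.<-≤-trans d<k (ℕP.≤-reflexive (sym (ℕP.m+[n∸m]≡n i≤k)))))

diag-degree≤total-degree : ∀ {Q d e} → TotalBounded Q d → HasDegree (diag Q) e → e ℕ.≤ d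
diag-degree≤total-degree Q≤d he = ℕP.≤-pred (Bounded₁⇒degree< (TotalBounded⇒diag-Bounded₁ Q≤d) he)

TotalBounded-*₂ : ∀ {Q R d e} → TotalBounded Q d → TotalBounded R e → TotalBounded (Q *₂ R) (d ℕ.+ e)
TotalBounded-*₂ {Q} {R} {d} {e} Q≤d R≤e i j d+e<i+j = sumTo-zero i _ λ a a≤i → sumTo-zero j _ λ b b≤j → term a b a≤i b≤j
  where
  term : ∀ a b → a ℕ.≤ i → b ℕ.≤ j → Q a b * R (i ∸ a) (j ∸ b) ≡ 0ℤ
  term a b a≤i b≤j with d ℕP.<? a ℕ.+ b
  ... | yes d<a+b = cong (_* R (i ∸ a) (j ∸ b)) (Q≤d a b d<a+b)
  ... | no  d≮a+b = trans (cong (Q a b *_) (R≤e (i ∸ a) (j ∸ b) e<rest)) (ℤP.*-zeroʳ (Q a b))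
    where
    split : (a ℕ.+ b) ℕ.+ ((i ∸ a) ℕ.+ (j ∸ b)) ≡ i ℕ.+ j
    split = trans (interchange a b (i ∸ a) (j ∸ b)) (cong₂ ℕ._+_ (ℕP.m+[n∸m]≡n a≤i) (ℕP.m+[n∸m]≡n b≤j))
      where
      interchange : ∀ a b x y → (a ℕ.+ b) ℕ.+ (x ℕ.+ y) ≡ (a ℕ.+ x) ℕ.+ (b ℕ.+ y)
      interchange = solve-ℕ
    e<rest : e ℕ.< (i ∸ a) ℕ.+ (j ∸ b)
    e<rest = ℕP.+-cancelˡ-< (a ℕ.+ b) e _ (begin-strict
      a ℕ.+ b ℕ.+ e  ≤⟨ ℕP.+-monoˡ-≤ e (ℕP.≮⇒≥ d≮a+b) ⟩
      d ℕ.+ e        <⟨ d+e<i+j ⟩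
      i ℕ.+ j        ≡⟨ split ⟨
      a ℕ.+ b ℕ.+ (i ∸ a ℕ.+ (j ∸ b)) ∎)
      where open ℕP.≤-Reasoning

-- On the antidiagonal of degree d + e only the term pairing the degree-d part of Q with
-- the degree-e part of R survives.
antidiagonal-single : ∀ {Q R} a x y z → TotalBounded Q (a ℕ.+ y) → TotalBounded R (x ℕ.+ z) →
                      sumTo (y ℕ.+ z) (λ b → Q a b * R x (y ℕ.+ z ∸ b)) ≡ Q a y * R x z
antidiagonal-single {Q} {R} a x y z Q≤a+y R≤x+z =
  trans (sumTo-single (y ℕ.+ z) y _ (ℕP.m≤m+n y z) off) (cong (λ w → Q a y * R x w) (ℕP.m+n∸m≡n y z))
  where
  off : ∀ b → b ℕ.≤ y ℕ.+ z → b ≢ y → Q a b * R x (y ℕ.+ z ∸ b) ≡ 0ℤ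
  off b b≤y+z b≢y with ℕP.<-cmp b y
  ... | tri≈ _ b≡y _ = contradiction b≡y b≢y
  ... | tri> _ _ y<b = cong (_* R x (y ℕ.+ z ∸ b)) (Q≤a+y a b (ℕP.+-monoʳ-< a y<b))
  ... | tri< b<y _ _ = trans (cong (Q a b *_) (R≤x+z x (y ℕ.+ z ∸ b) (ℕP.+-monoʳ-< x z<y+z∸b))) (ℤP.*-zeroʳ (Q a b))
    where
    z<y+z∸b : z ℕ.< y ℕ.+ z ∸ b
    z<y+z∸b = ℕP.m+n≤o⇒m≤o∸n (suc z) (begin
      suc z ℕ.+ b ≡⟨ cong suc (ℕP.+-comm z b) ⟩
      suc b ℕ.+ z ≤⟨ ℕP.+-monoˡ-≤ z b<y ⟩
      y ℕ.+ z     ∎)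
      where open ℕP.≤-Reasoning

top-*₂-term : ∀ {Q R d e} → TotalBounded Q d → TotalBounded R e → ∀ a x J → a ℕ.+ x ℕ.+ J ≡ d ℕ.+ e →
              sumTo J (λ b → Q a b * R x (J ∸ b)) ≡ top d Q a * top e R x
top-*₂-term {Q} {R} {d} {e} Q≤d R≤e a x J a+x+J≡d+e with d ℕP.<? a | e ℕP.<? x
... | yes d<a | _ =
  trans (sumTo-zero J _ (λ b _ → cong (_* R x (J ∸ b)) (Q≤d a b (ℕP.<-≤-trans d<a (ℕP.m≤m+n a b)))))
        (sym (cong (_* top e R x) (Q≤d a (d ∸ a) (ℕP.<-≤-trans d<a (ℕP.m≤m+n a (d ∸ a))))))
... | no _ | yes e<x =
  trans (sumTo-zero J _ (λ b _ → trans (cong (Q a b *_) (R≤e x (J ∸ b) (ℕP.<-≤-trans e<x (ℕP.m≤m+n x (J ∸ b)))))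
                                       (ℤP.*-zeroʳ (Q a b))))
        (sym (trans (cong (top d Q a *_) (R≤e x (e ∸ x) (ℕP.<-≤-trans e<x (ℕP.m≤m+n x (e ∸ x)))))
                    (ℤP.*-zeroʳ (top d Q a))))
... | no d≮a | no e≮x =
  trans (cong (λ J′ → sumTo J′ (λ b → Q a b * R x (J′ ∸ b))) J≡y+z)
        (antidiagonal-single a x y z (subst (TotalBounded Q) d≡a+y Q≤d) (subst (TotalBounded R) e≡x+z R≤e))
  where
  y = d ∸ a
  z = e ∸ x
  d≡a+y : d ≡ a ℕ.+ y
  d≡a+y = sym (ℕP.m+[n∸m]≡n (ℕP.≮⇒≥ d≮a))
  e≡x+z : e ≡ x ℕ.+ z
  e≡x+z = sym (ℕP.m+[n∸m]≡n (ℕP.≮⇒≥ e≮x))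
  J≡y+z : J ≡ y ℕ.+ z
  J≡y+z = ℕP.+-cancelˡ-≡ (a ℕ.+ x) J (y ℕ.+ z)
    (trans a+x+J≡d+e (trans (cong₂ ℕ._+_ d≡a+y e≡x+z) (interchange a y x z)))
    where
    interchange : ∀ a y x z → (a ℕ.+ y) ℕ.+ (x ℕ.+ z) ≡ (a ℕ.+ x) ℕ.+ (y ℕ.+ z)
    interchange = solve-ℕ

top-*₂ : ∀ {Q R d e} → TotalBounded Q d → TotalBounded R e →
         ∀ i → i ℕ.≤ d ℕ.+ e → top (d ℕ.+ e) (Q *₂ R) i ≡ (top d Q *₁ top e R) i
top-*₂ {Q} {R} {d} {e} Q≤d R≤e i i≤d+e = sumTo-cong≤ i λ a a≤i →
  top-*₂-term Q≤d R≤e a (i ∸ a) (d ℕ.+ e ∸ i)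
    (trans (cong (ℕ._+ (d ℕ.+ e ∸ i)) (ℕP.m+[n∸m]≡n a≤i)) (ℕP.m+[n∸m]≡n i≤d+e))

HasTotalDegree-*₂ : ∀ {Q R d e} → HasTotalDegree Q d → HasTotalDegree R e → HasTotalDegree (Q *₂ R) (d ℕ.+ e)
HasTotalDegree-*₂ {Q} {R} {d} {e} (Q≤d , topQ≉0) (R≤e , topR≉0)
  with ≉0⇒degree (suc d , IsPoly₁-top Q≤d) topQ≉0 | ≉0⇒degree (suc e , IsPoly₁-top R≤e) topR≉0
... | d′ , hd′ | e′ , he′ = TotalBounded-*₂ Q≤d R≤e , λ top≈0 →
  proj₁ (HasDegree-* hd′ he′) (trans (sym (top-*₂ Q≤d R≤e (d′ ℕ.+ e′) d′+e′≤d+e)) (top≈0 (d′ ℕ.+ e′)))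
  where
  d′+e′≤d+e : d′ ℕ.+ e′ ℕ.≤ d ℕ.+ e
  d′+e′≤d+e = ℕP.+-mono-≤ (ℕP.≤-pred (Bounded₁⇒degree< (IsPoly₁-top Q≤d) hd′))
                          (ℕP.≤-pred (Bounded₁⇒degree< (IsPoly₁-top R≤e) he′))

IsPoly₂-*₂ : ∀ {Q R} → IsPoly₂ Q → IsPoly₂ R → IsPoly₂ (Q *₂ R)
IsPoly₂-*₂ (N , Q≡0) (M , R≡0) = suc (N ℕ.+ M) , λ i j N+M<i+j →
  TotalBounded-*₂ (λ i j N<i+j → Q≡0 i j (ℕP.<⇒≤ N<i+j)) (λ i j M<i+j → R≡0 i j (ℕP.<⇒≤ M<i+j)) i j N+M<i+j

IsPoly₂-prod : ∀ {L} → All IsPoly₂ L → IsPoly₂ (prod₂ L)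
IsPoly₂-prod []         = 1 , λ { zero zero () ; zero (suc j) _ → refl ; (suc i) j _ → refl }
IsPoly₂-prod (pQ ∷ pL) = IsPoly₂-*₂ pQ (IsPoly₂-prod pL)

diag-prod₂ : ∀ L → diag (prod₂ L) ≈₁ prod₁ (map diag L)
diag-prod₂ []      = diag-one₂
diag-prod₂ (Q ∷ L) = ≈₁-trans (diag-*₂ Q (prod₂ L)) (*₁-congˡ (diag Q) (diag-prod₂ L))

DiagonalPreservesDegree : Coeffs₂ → Set
DiagonalPreservesDegree Q = ∃ λ d → HasTotalDegree Q d × HasDegree (diag Q) d

-- deg diag ≤ total degree for each factor, and both degrees are additive.
DiagonalPreservesDegree-*₂ : ∀ {Q R} → IsPoly₂ Q → IsPoly₂ R → ¬ Q ≈₂ zero₂ → ¬ R ≈₂ zero₂ →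
  DiagonalPreservesDegree (Q *₂ R) → DiagonalPreservesDegree Q × DiagonalPreservesDegree R
DiagonalPreservesDegree-*₂ {Q} {R} pQ pR Q≉0 R≉0 (d , hT , hD)
  with ≉0⇒total-degree pQ Q≉0 | ≉0⇒total-degree pR R≉0
     | ≉0⇒degree (IsPoly₁-diag pQ) (diag≉0 {Q} (*₁-zeroˡ (diag R)))
     | ≉0⇒degree (IsPoly₁-diag pR) (diag≉0 {R} (≈₁-trans (*₁-comm (diag Q) (diag R)) ∘ *₁-zeroˡ (diag Q)))
  where
  diag≉0 : ∀ {S} → (diag S ≈₁ zero₁ → (diag Q *₁ diag R) ≈₁ zero₁) → ¬ diag S ≈₁ zero₁
  diag≉0 product≈0 diag≈0 = HasDegree⇒≉0 (HasDegree-resp-≈ (diag-*₂ Q R) hD) (product≈0 diag≈0)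
... | dQ , hQ | dR , hR | eQ , heQ | eR , heR = (dQ , hQ , subst (HasDegree (diag Q)) eQ≡dQ heQ)
                                                , (dR , hR , subst (HasDegree (diag R)) eR≡dR heR)
  where
  eQ+eR≡dQ+dR : eQ ℕ.+ eR ≡ dQ ℕ.+ dR
  eQ+eR≡dQ+dR = trans (HasDegree-unique (HasDegree-resp-≈ (≈₁-sym (diag-*₂ Q R)) (HasDegree-* heQ heR)) hD)
                      (HasTotalDegree-unique hT (HasTotalDegree-*₂ hQ hR))
  eQ≤dQ = diag-degree≤total-degree (proj₁ hQ) heQ
  eR≤dR = diag-degree≤total-degree (proj₁ hR) heR
  eQ≡dQ : eQ ≡ dQ
  eQ≡dQ with ℕP.m≤n⇒m<n∨m≡n eQ≤dQ
  ... | inj₂ eQ≡dQ = eQ≡dQ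
  ... | inj₁ eQ<dQ = contradiction eQ+eR≡dQ+dR (ℕP.<⇒≢ (ℕP.+-mono-<-≤ eQ<dQ eR≤dR))
  eR≡dR : eR ≡ dR
  eR≡dR = ℕP.+-cancelˡ-≡ eQ eR dR (trans eQ+eR≡dQ+dR (cong (ℕ._+ dR) (sym eQ≡dQ)))

-- The two features of a generating polynomial that the argument uses.
Admissible : Coeffs₂ → Set
Admissible Q = ∣ Q 0 0 ∣ ≡ 1 × DiagonalPreservesDegree Q

Admissible-resp-≈ : ∀ {Q Q′} → Q ≈₂ Q′ → Admissible Q → Admissible Q′
Admissible-resp-≈ Q≈Q′ (∣Q00∣≡1 , d , hT , hD) =
  trans (cong ∣_∣ (sym (Q≈Q′ 0 0))) ∣Q00∣≡1 , d , HasTotalDegree-resp-≈ Q≈Q′ hT , HasDegree-resp-≈ (diag-cong Q≈Q′) hD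

Admissible-*₂ : ∀ {Q R} → IsPoly₂ Q → IsPoly₂ R → Admissible (Q *₂ R) → Admissible Q × Admissible R
Admissible-*₂ {Q} {R} pQ pR (∣QR00∣≡1 , QR-preserves) =
  (∣Q00∣≡1 , proj₁ preserves) , (∣R00∣≡1 , proj₂ preserves)
  where
  ∣Q00∣*∣R00∣≡1 : ∣ Q 0 0 ∣ ℕ.* ∣ R 0 0 ∣ ≡ 1
  ∣Q00∣*∣R00∣≡1 = trans (sym (ℤP.abs-* (Q 0 0) (R 0 0))) ∣QR00∣≡1
  ∣Q00∣≡1 = ℕP.m*n≡1⇒m≡1 ∣ Q 0 0 ∣ _ ∣Q00∣*∣R00∣≡1
  ∣R00∣≡1 = ℕP.m*n≡1⇒n≡1 ∣ Q 0 0 ∣ _ ∣Q00∣*∣R00∣≡1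
  preserves = DiagonalPreservesDegree-*₂ pQ pR (λ Q≈0 → ∣i∣≡1⇒i≢0 ∣Q00∣≡1 (Q≈0 0 0))
                                              (λ R≈0 → ∣i∣≡1⇒i≢0 ∣R00∣≡1 (R≈0 0 0)) QR-preserves

Admissible-prod₂ : ∀ {L} → All IsPoly₂ L → Admissible (prod₂ L) → All Admissible L
Admissible-prod₂ []         _       = []
Admissible-prod₂ (pQ ∷ pL) adm-QL =
  proj₁ split ∷ Admissible-prod₂ pL (proj₂ split)
  where split = Admissible-*₂ pQ (IsPoly₂-prod pL) adm-QL

TotalBounded0-*₂ : ∀ {Q} X → TotalBounded Q 0 → ∀ i j → (Q *₂ X) i j ≡ Q 0 0 * X i j
TotalBounded0-*₂ {Q} X Q≤0 i j =
  trans (sumTo-single i 0 _ z≤n (λ { zero _ 0≢0 → contradiction refl 0≢0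
                                   ; (suc a) _ _ → sumTo-zero j _ (λ b _ → cong (_* _) (Q≤0 (suc a) b (s≤s z≤n))) }))
        (sumTo-single j 0 _ z≤n (λ { zero _ 0≢0 → contradiction refl 0≢0
                                   ; (suc b) _ _ → cong (_* _) (Q≤0 0 (suc b) (s≤s z≤n)) }))

IsUnit₁-diag⇒IsUnit₂ : ∀ {Q} → IsPoly₂ Q → Admissible Q → IsUnit₁ (diag Q) → IsUnit₂ Q
IsUnit₁-diag⇒IsUnit₂ {Q} pQ (∣Q00∣≡1 , d , (Q≤d , _) , hD) diag-unit = pQ , Q , pQ , QQ≈1
  where
  Q≤0 : TotalBounded Q 0
  Q≤0 = subst (TotalBounded Q) (HasDegree-unique hD (IsUnit₁-degree diag-unit)) Q≤d
  QQ≈1 : (Q *₂ Q) ≈₂ one₂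
  QQ≈1 i j = trans (TotalBounded0-*₂ Q Q≤0 i j) (Q00*Qij i j)
    where
    Q00*Qij : ∀ i j → Q 0 0 * Q i j ≡ one₂ i j
    Q00*Qij zero    zero    = ∣i∣≡1⇒i*i≡1 (Q 0 0) ∣Q00∣≡1
    Q00*Qij zero    (suc j) = trans (cong (Q 0 0 *_) (Q≤0 0 (suc j) (s≤s z≤n))) (ℤP.*-zeroʳ (Q 0 0))
    Q00*Qij (suc i) j       = trans (cong (Q 0 0 *_) (Q≤0 (suc i) j (s≤s z≤n))) (ℤP.*-zeroʳ (Q 0 0))

nonunit-diagonals : ∀ {L} → All Irreducible₂ L → All Admissible L → All NonUnit₁ (map diag L)
nonunit-diagonals []           []           = []
nonunit-diagonals (irr ∷ irrs) (adm ∷ adms) =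
  (IsPoly₁-diag (proj₁ irr) , proj₁ (proj₂ (proj₂ irr)) ∘ IsUnit₁-diag⇒IsUnit₂ (proj₁ irr) adm)
  ∷ nonunit-diagonals irrs adms

Admissible⇒factor-count≤ : ∀ {P L₂ L₁} → Admissible P → IsFactorization₂ P L₂ → IsFactorization₁ (diag P) L₁ →
                            length L₂ ≤ length L₁
Admissible⇒factor-count≤ {P} {L₂} {L₁} adm (irrs₂ , L₂≈P) (irrs₁ , L₁≈diagP) =
  subst (_≤ length L₁) (length-map diag L₂)
    (length-nonunits≤length-irreducibles L₁ irrs₁ (map diag L₂)
      (nonunit-diagonals irrs₂ (Admissible-prod₂ (All.map proj₁ irrs₂) (Admissible-resp-≈ (≈₂-sym L₂≈P) adm)))
      (≈₁-trans (≈₁-sym (diag-prod₂ L₂)) (≈₁-trans (diag-cong L₂≈P) (≈₁-sym L₁≈diagP))))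

Admissible-diag-Irreducible⇒Irreducible : ∀ {P} → IsPoly₂ P → Admissible P → Irreducible₁ (diag P) → Irreducible₂ P
Admissible-diag-Irreducible⇒Irreducible {P} pP adm (_ , _ , diag-nonunit , diag-irr) =
  pP , (λ P≈0 → ∣i∣≡1⇒i≢0 (proj₁ adm) (P≈0 0 0)) , diag-nonunit ∘ IsUnit₂⇒IsUnit₁-diag , factors
  where
  factors : ∀ a b → IsPoly₂ a → IsPoly₂ b → P ≈₂ (a *₂ b) → IsUnit₂ a ⊎ IsUnit₂ b
  factors a b pa pb P≈ab =
    Sum.map (IsUnit₁-diag⇒IsUnit₂ pa (proj₁ adm-ab)) (IsUnit₁-diag⇒IsUnit₂ pb (proj₂ adm-ab))
      (diag-irr (diag a) (diag b) (IsPoly₁-diag pa) (IsPoly₁-diag pb) (≈₁-trans (diag-cong P≈ab) (diag-*₂ a b)))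
    where
    adm-ab = Admissible-*₂ pa pb (Admissible-resp-≈ P≈ab adm)

-- Generating polynomials

level : ℕ × ℕ → ℕ
level (a , b) = a ℕ.+ b

≡ᵇ-refl : ∀ n → (n ≡ᵇ n) ≡ true
≡ᵇ-refl zero    = refl
≡ᵇ-refl (suc n) = ≡ᵇ-refl n

countPt-off : ∀ {i j} ps → All (λ pt → level pt ≢ i ℕ.+ j) ps → countPt i j ps ≡ 0
countPt-off             []             []                = refl
countPt-off {i} {j} ((a , b) ∷ ps) (a+b≢i+j ∷ rest) with i ≡ᵇ a in i≡ᵇa | j ≡ᵇ b in j≡ᵇb
... | false | _     = countPt-off ps rest
... | true  | false = countPt-off ps rest
... | true  | true  = contradiction (sym (cong₂ ℕ._+_ (ℕP.≡ᵇ⇒≡ i a (subst T (sym i≡ᵇa) _))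
                                                     (ℕP.≡ᵇ⇒≡ j b (subst T (sym j≡ᵇb) _)))) a+b≢i+j

countPt-on : ∀ {i j} ps → (i , j) ∈ ps → 1 ℕ.≤ countPt i j ps
countPt-on {i} {j} (_ ∷ ps) (here refl) rewrite ≡ᵇ-refl i | ≡ᵇ-refl j = s≤s z≤n
countPt-on {i} {j} ((a , b) ∷ ps) (there ij∈ps) =
  ℕP.≤-trans (countPt-on ps ij∈ps) (ℕP.m≤n+m _ (if (i ≡ᵇ a) ∧ (j ≡ᵇ b) then 1 else 0))

Between : ℕ → ℕ → ℕ × ℕ → Set
Between n len pt = n ℕ.≤ level pt × level pt ℕ.≤ n ℕ.+ len

prefixPoints-levels : ∀ a b s → All (Between (a ℕ.+ b) (length s)) (prefixPoints a b s)
prefixPoints-levels a b []          = (ℕP.≤-refl , ℕP.m≤m+n (a ℕ.+ b) 0) ∷ []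
prefixPoints-levels a b (false ∷ s) =
  (ℕP.≤-refl , ℕP.m≤m+n (a ℕ.+ b) (suc (length s))) ∷ All.map (λ {pt} → widen {pt}) (prefixPoints-levels (suc a) b s)
  where
  widen : ∀ {pt} → Between (suc (a ℕ.+ b)) (length s) pt → Between (a ℕ.+ b) (suc (length s)) pt
  widen (lo , hi) = ℕP.<⇒≤ lo , ℕP.≤-trans hi (ℕP.≤-reflexive (sym (ℕP.+-suc (a ℕ.+ b) (length s))))
prefixPoints-levels a b (true ∷ s)  =
  (ℕP.≤-refl , ℕP.m≤m+n (a ℕ.+ b) (suc (length s))) ∷ All.map (λ {pt} → widen {pt}) (prefixPoints-levels a (suc b) s)
  where
  widen : ∀ {pt} → Between (a ℕ.+ suc b) (length s) pt → Between (a ℕ.+ b) (suc (length s)) pt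
  widen {pt} (lo , hi) = ℕP.<⇒≤ (subst (ℕ._≤ level pt) (ℕP.+-suc a b) lo) ,
                    ℕP.≤-trans hi (ℕP.≤-reflexive (trans (cong (ℕ._+ length s) (ℕP.+-suc a b)) (sym (ℕP.+-suc (a ℕ.+ b) (length s)))))

prefixPoints-last : ∀ a b s → ∃ λ pt → pt ∈ prefixPoints a b s × level pt ≡ a ℕ.+ b ℕ.+ length s
prefixPoints-last a b [] = (a , b) , here refl , sym (ℕP.+-identityʳ _)
prefixPoints-last a b (false ∷ s) with prefixPoints-last (suc a) b s
... | pt , pt∈ , lv = pt , there pt∈ , trans lv (sym (ℕP.+-suc (a ℕ.+ b) (length s)))
prefixPoints-last a b (true ∷ s) with prefixPoints-last a (suc b) s
... | pt , pt∈ , lv = pt , there pt∈ ,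
  trans lv (trans (cong (ℕ._+ length s) (ℕP.+-suc a b)) (sym (ℕP.+-suc (a ℕ.+ b) (length s))))

countPt-origin-above : ∀ a b s → 0 ℕ.< a ℕ.+ b → countPt 0 0 (prefixPoints a b s) ≡ 0
countPt-origin-above a b s 0<a+b = countPt-off _ (All.map (λ {pt} → level≢0 {pt}) (prefixPoints-levels a b s))
  where
  level≢0 : ∀ {pt} → Between (a ℕ.+ b) (length s) pt → level pt ≢ 0
  level≢0 (a+b≤level , _) level≡0 = ℕP.<⇒≢ (ℕP.<-≤-trans 0<a+b a+b≤level) (sym level≡0)

genPoly-origin : ∀ s → genPoly s 0 0 ≡ 1ℤ
genPoly-origin []          = refl
genPoly-origin (false ∷ s) = cong (λ m → + suc m) (countPt-origin-above 1 0 s (s≤s z≤n))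
genPoly-origin (true ∷ s)  = cong (λ m → + suc m) (countPt-origin-above 0 1 s (s≤s z≤n))

genPoly-TotalBounded : ∀ s → TotalBounded (genPoly s) (length s)
genPoly-TotalBounded s i j n<i+j = cong +_ (countPt-off _ (All.map (λ {pt} → level≢ {pt}) (prefixPoints-levels 0 0 s)))
  where
  level≢ : ∀ {pt} → Between 0 (length s) pt → level pt ≢ i ℕ.+ j
  level≢ (_ , level≤n) level≡i+j = ℕP.<-irrefl refl (ℕP.<-≤-trans n<i+j (subst (ℕ._≤ length s) level≡i+j level≤n))

genPoly-DiagonalPreservesDegree : ∀ s → DiagonalPreservesDegree (genPoly s)
genPoly-DiagonalPreservesDegree s with prefixPoints-last 0 0 s
... | (i , j) , ij∈ , i+j≡n = n , (genPoly-TotalBounded s , top≉0) , diag-n≢0 , TotalBounded⇒diag-Bounded₁ (genPoly-TotalBounded s)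
  where
  n = length s
  P = genPoly s
  n∸i≡j : n ∸ i ≡ j
  n∸i≡j = trans (cong (_∸ i) (sym i+j≡n)) (ℕP.m+n∸m≡n i j)
  1≤P : + 1 ℤ.≤ P i (n ∸ i)
  1≤P = subst (λ z → + 1 ℤ.≤ P i z) (sym n∸i≡j) (ℤ.+≤+ (countPt-on _ ij∈))
  positive⇒≢0 : ∀ {x} → + 1 ℤ.≤ x → x ≢ 0ℤ
  positive⇒≢0 1≤x x≡0 = ℤP.<-irrefl refl (ℤP.<-≤-trans (ℤ.+<+ (s≤s z≤n)) (subst (+ 1 ℤ.≤_) x≡0 1≤x))
  top≉0 : ¬ top n P ≈₁ zero₁
  top≉0 top≈0 = positive⇒≢0 1≤P (top≈0 i)
  diag-n≢0 : diag P n ≢ 0ℤ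
  diag-n≢0 = positive⇒≢0 (ℤP.≤-trans 1≤P
    (term≤sumTo n (λ a → P a (n ∸ a)) (λ a → ℤ.+≤+ z≤n) i (subst (i ℕ.≤_) i+j≡n (ℕP.m≤m+n i j))))

genPoly-Admissible : ∀ s → Admissible (genPoly s)
genPoly-Admissible s = cong ∣_∣ (genPoly-origin s) , genPoly-DiagonalPreservesDegree s

IsPoly₂-genPoly : ∀ s → IsPoly₂ (genPoly s)
IsPoly₂-genPoly s = suc (length s) , λ i j → genPoly-TotalBounded s i j

lemma10 : (s : List Bool) →
    ((L₂ : List Coeffs₂) (L₁ : List Coeffs₁) →
       IsFactorization₂ (genPoly s) L₂ →
       IsFactorization₁ (diag (genPoly s)) L₁ →
       length L₂ ≤ length L₁)
    × (Irreducible₁ (diag (genPoly s)) → Irreducible₂ (genPoly s))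
lemma10 s =
  (λ _ _ → Admissible⇒factor-count≤ (genPoly-Admissible s)) ,
  Admissible-diag-Irreducible⇒Irreducible (IsPoly₂-genPoly s) (genPoly-Admissible s)
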